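{- The product $\times$ and the composition $\circ$ of arborescent moulds are associative, and composition distributes on the right over the product: $(M\times M')\circ N=(M\circ N)\times(M'\circ N)$ for all arborescent moulds $M,M',N$. The arborescent mould $\varepsilon$ with $\varepsilon^\emptyset=1$ and $\varepsilon^F=0$ for every nonempty forest $F$ is a unit for $\times$, and the arborescent mould $I_<$ with $I_<^{\bullet_\omega}=1$ for every $\omega\in\Omega$ and $I_<^F=0$ when $F=\emptyset$ or $F$ has at least two vertices is a right unit for $\circ$, i.e. $M\circ I_<=M$.
   Context: $\mathcal A$ is a commutative unital algebra over a field, $\Omega$ a set with a commutative semigroup law written additively. A rooted forest is a finite oriented acyclic graph in which every vertex has at most one incoming edge; $\mathcal V(F)$ is partially ordered by $u\le v$ iff an oriented path from a root passes through $u$ to $v$; $\Omega$-decorated forests carry $d:\mathcal V(F)\to\Omega$; $\bullet_\omega$ is the one-vertex forest decorated by $\omega$, $\emptyset$ the empty forest. An arborescent mould is a map $F\mapsto M^F\in\mathcal A$ on $\Omega$-decorated rooted forests (equivalently a linear form on their span). For $V\subseteq\mathcal V(F)$, $F|_V$ keeps the vertices of $V$ and the edges between them. Product: $(M\times N)^F=\sum M^{F|_{V_1}}N^{F|_{V_2}}$ over all partitions $V_1\sqcup V_2=\mathcal V(F)$ such that no element of $V_2$ is strictly smaller than an element of $V_1$. A covering subforest $G$ of $F$ is a partition of $\mathcal V(F)$ into blocks each inducing a connected subgraph of $F$, viewed as the forest on $\mathcal V(F)$ with the edges of $F$ inside blocks; its connected components $G_1,\ldots,G_r$ are the blocks; $F/G$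 shrinks each block to one vertex decorated by the internal sum of the decorations of the block. Composition: $(M\circ N)^F=\sum_{G}M^{F/G}N^{G_1}\cdots N^{G_r}$ over all covering subforests $G=G_1\cdots G_r$ of $F$ (for $F=\emptyset$ this gives $M^\emptyset$). -}

module Defs where

open import Level using (Level; _⊔_)
open import Data.Nat using (ℕ; zero; suc)
open import Data.Fin using (Fin; zero; suc; _≟_)
open import Data.Bool using (Bool; true; false; not; _∨_; _∧_; if_then_else_)
open import Data.Vec using (Vec; []; _∷_; lookup; tabulate)
open import Data.Maybe using (Maybe; just; nothing; _>>=_; is-just)
import Data.Maybe as Maybe
open import Data.List using (List; []; _∷_; foldr; allFin; filterᵇ; concatMap)
import Data.List as List
open import Data.Product using (Σ; _,_; proj₁; proj₂)
open import Relation.Nullary using (does)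
open import Relation.Binary.PropositionalEquality using (_≡_)
open import Function.Bundles using (_↔_; Inverse)
open import Algebra.Bundles using (CommutativeRing)

-- A forest with n vertices is built by adding vertices one at a time;
-- `node ω p F` adds a new vertex (index `zero`) decorated by ω, whose
-- parent is `p` (nothing = it is a root; just q = the vertex q of F,
-- which becomes `suc q`).  Every finite Ω-decorated rooted forest has
-- such a presentation (order its vertices so that parents come first),
-- and acyclicity / "at most one incoming edge" is built in.

data Forest {o} (Ω : Set o) : ℕ → Set o where
  ∅    : Forest Ω zero
  node : ∀ {n} → Ω → Maybe (Fin n) → Forest Ω n → Forest Ω (suc n)

allSubsets : (n : ℕ) → List (Vec Bool n)
allSubsets zero    = [] ∷ []
allSubsets (suc n) = concatMap (λ V → (true ∷ V) ∷ (false ∷ V) ∷ []) (allSubsets n)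

allᵇ : ∀ {a} {A : Set a} → (A → Bool) → List A → Bool
allᵇ p = foldr (λ x b → p x ∧ b) true

module _ {o} {Ω : Set o} where

  parentOf : ∀ {n} → Forest Ω n → Fin n → Maybe (Fin n)
  parentOf (node ω p F) zero    = Maybe.map suc p
  parentOf (node ω p F) (suc i) = Maybe.map suc (parentOf F i)

  decoOf : ∀ {n} → Forest Ω n → Fin n → Ω
  decoOf (node ω p F) zero    = ω
  decoOf (node ω p F) (suc i) = decoOf F i

  -- strict ancestors of v: the u with u < v in the forest order
  ancestors : ∀ {n} → Forest Ω n → Fin n → List (Fin n)
  ancestors (node ω nothing F)  zero    = []
  ancestors (node ω (just q) F) zero    = suc q ∷ List.map suc (ancestors F q)
  ancestors (node ω p F)        (suc i) = List.map suc (ancestors F i)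

  record _≅_ {n} (F F′ : Forest Ω n) : Set o where
    field
      bij      : Fin n ↔ Fin n
    open Inverse bij using (to)
    field
      parent-pres : ∀ i → parentOf F′ (to i) ≡ Maybe.map to (parentOf F i)
      deco-pres   : ∀ i → decoOf F′ (to i) ≡ decoOf F i

  restrict : ∀ {n} → Forest Ω n → Vec Bool n →
             Σ ℕ (λ m → Σ (Forest Ω m) (λ _ → Fin n → Maybe (Fin m)))
  restrict ∅ [] = zero , ∅ , λ ()
  restrict (node ω p F) (b ∷ V) with restrict F V
  ... | m , F′ , f with b
  ...   | true  = suc m , node ω (p >>= f) F′ , g
    where g : Fin _ → Maybe (Fin (suc m))
          g zero    = just zero
          g (suc i) = Maybe.map suc (f i)
  ...   | false = m , F′ , g
    where g : Fin _ → Maybe (Fin m)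
          g zero    = nothing
          g (suc i) = f i

  _∣_ : ∀ {n} → Forest Ω n → Vec Bool n → Σ ℕ (Forest Ω)
  F ∣ V = proj₁ (restrict F V) , proj₁ (proj₂ (restrict F V))

  -- Partition V₁ ⊔ V₂ (V₁ = true part, V₂ = false part) is admissible for
  -- the product iff no element of V₂ is strictly smaller than an element of V₁.
  productAdmissible : ∀ {n} → Forest Ω n → Vec Bool n → Bool
  productAdmissible {n} F V =
    allᵇ (λ v → not (lookup V v) ∨ allᵇ (λ u → lookup V u) (ancestors F v)) (allFin n)

  -- Covering subforests G of F are given by their (spanning) edge sets:
  -- S v ≡ true means the edge parent(v) → v of F is kept in G.  Only
  -- non-root vertices carry an edge, so S must be false on roots.
  coverAdmissible : ∀ {n} → Forest Ω n → Vec Bool n → Bool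
  coverAdmissible {n} F S =
    allᵇ (λ v → not (lookup S v) ∨ is-just (parentOf F v)) (allFin n)

  module Quotient (_⊕_ : Ω → Ω → Ω) where

    addDeco : ∀ {m} → Forest Ω m → Fin m → Ω → Forest Ω m
    addDeco (node ω p F) zero    α = node (ω ⊕ α) p F
    addDeco (node ω p F) (suc j) α = node ω p (addDeco F j α)

    -- F/G for the covering subforest with edge set S: returns the
    -- shrunk forest (one vertex per block = connected component of G,
    -- decorated by the sum of the decorations of the block) together
    -- with the map vertex ↦ its block.
    quotient : ∀ {n} → Forest Ω n → Vec Bool n →
               Σ ℕ (λ m → Σ (Forest Ω m) (λ _ → Fin n → Fin m))
    quotient ∅ [] = zero , ∅ , λ ()
    quotient (node ω p F) (s ∷ S) with quotient F S
    ... | m , Q , f with s | p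
    ...   | true | just q = m , addDeco Q (f q) ω , g
      where g : Fin _ → Fin m
            g zero    = f q
            g (suc i) = f i
    ...   | _    | _      = suc m , node ω (Maybe.map f p) Q , g
      where g : Fin _ → Fin (suc m)
            g zero    = zero
            g (suc i) = suc (f i)

    blockOf : ∀ {n m} → (Fin n → Fin m) → Fin m → Vec Bool n
    blockOf f j = tabulate (λ v → does (f v ≟ j))

module MouldOps {c ℓ} (R : CommutativeRing c ℓ) {o} {Ω : Set o} (_⊕_ : Ω → Ω → Ω) where
  open CommutativeRing R
  open Quotient {Ω = Ω} _⊕_

  Mould : Set (c ⊔ o)
  Mould = ∀ {n} → Forest Ω n → Carrier

  -- moulds are functions of forests, i.e. invariant under isomorphism
  Invariant : Mould → Set (o ⊔ ℓ)
  Invariant M = ∀ {n} {F F′ : Forest Ω n} → F ≅ F′ → M F ≈ M F′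

  _≋_ : Mould → Mould → Set (o ⊔ ℓ)
  M ≋ N = ∀ {n} (F : Forest Ω n) → M F ≈ N F

  sumL : List Carrier → Carrier
  sumL = foldr _+_ 0#

  prodFin : (m : ℕ) → (Fin m → Carrier) → Carrier
  prodFin m g = foldr (λ j acc → g j * acc) 1# (allFin m)

  app : Mould → Σ ℕ (Forest Ω) → Carrier
  app M (_ , F) = M F

  _⊠_ : Mould → Mould → Mould
  (M ⊠ N) {n} F =
    sumL (List.map (λ V → app M (F ∣ V) * app N (F ∣ Data.Vec.map not V))
                   (filterᵇ (productAdmissible F) (allSubsets n)))

  compTerm : Mould → Mould → ∀ {n} → Forest Ω n → Vec Bool n → Carrier
  compTerm M N F S with quotient F S
  ... | m , Q , f = M Q * prodFin m (λ j → app N (F ∣ blockOf f j))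

  _⊚_ : Mould → Mould → Mould
  (M ⊚ N) {n} F =
    sumL (List.map (compTerm M N F) (filterᵇ (coverAdmissible F) (allSubsets n)))

  ε : Mould
  ε {zero}  _ = 1#
  ε {suc n} _ = 0#

  I< : Mould
  I< {suc zero} _ = 1#
  I< {zero}     _ = 0#
  I< {suc (suc n)} _ = 0#

-- Both operations are finite sums over subsets of the vertex set of F: the
-- product over the down-closed sets V (the part read by M), the composition over
-- the edge sets S of covering subforests. Each identity is proved forest by forest
-- by expanding both sides into a double sum over pairs of subsets and matching
-- the summands after a change of summation variables. For × the pairs X ⊆ V
-- correspond to the disjoint pairs (X, V ∖ X). For ∘ an edge set of F/S is an
-- edge set X of F disjoint from S; then (F/S)/X = F/(S ∪ X), and the blocks of
-- S inside a block of S ∪ X are the blocks of S restricted to it. For the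
-- distributivity, a down-closed set of F/S is a down-closed union W of blocks of
-- S, and restricting F/S to it is quotienting F|W by S. For the units only the
-- empty vertex set (ε), resp. the empty edge set (I<: a kept edge makes a block
-- with two vertices), contributes.

module Submission where

open import Defs
open import Data.Nat using (ℕ; zero; suc)
open import Data.Fin using (Fin; zero; suc; _≟_)
import Data.Fin.Properties as FinP
open import Data.Fin.Subset using (Subset; ∁; _∩_; _∪_)
open import Data.Bool using (Bool; true; false; not; _∨_; _∧_)
open import Data.Bool.Properties using (∧-zeroʳ; ∨-zeroʳ; ∧-assoc; ∧-idem; ∧-identityʳ; not-involutive)
open import Data.Vec using (Vec; []; _∷_; lookup; tabulate; replicate)
open import Data.Vec.Properties using (lookup-replicate; lookup∘tabulate)
import Data.Vec as Vec
open import Data.Maybe using (Maybe; just; nothing; _>>=_; is-just)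
import Data.Maybe as Maybe
open import Data.Maybe.Properties using (just-injective; map-cong)
open import Data.List using (List; []; _∷_; foldr; allFin; filterᵇ; concatMap)
import Data.List as List
open import Data.Product using (Σ; _,_; proj₁; proj₂; _×_)
open import Data.Empty using (⊥-elim; ⊥)
open import Relation.Nullary using (does; ¬_; yes; no)
open import Relation.Nullary.Decidable using (dec-true; dec-false)
open import Relation.Binary.PropositionalEquality as P using (_≡_; refl; cong; cong₂)
open import Algebra.Bundles using (CommutativeRing; CommutativeSemiring)
open import Algebra.Structures using (IsCommutativeSemigroup)
import Algebra.Properties.CommutativeSemigroup as CSP

isEmptyᵇ : ∀ {n} → Subset n → Bool
isEmptyᵇ [] = true
isEmptyᵇ (true ∷ V) = false
isEmptyᵇ (false ∷ V) = isEmptyᵇ V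

∁-involutive : ∀ {n} (V : Subset n) → ∁ (∁ V) ≡ V
∁-involutive [] = refl
∁-involutive (b ∷ V) = cong₂ _∷_ (not-involutive b) (∁-involutive V)

∁-∅ : ∀ n → ∁ (replicate n false) ≡ replicate n true
∁-∅ zero = refl
∁-∅ (suc n) = cong (true ∷_) (∁-∅ n)

allᵇ-true : ∀ {A : Set} (p : A → Bool) (xs : List A) → (∀ x → p x ≡ true) → allᵇ p xs ≡ true
allᵇ-true p [] h = refl
allᵇ-true p (x ∷ xs) h rewrite h x = allᵇ-true p xs h

>>=-just : ∀ {n} (p : Maybe (Fin n)) f → (∀ i → f i ≡ just i) → (p >>= f) ≡ p
>>=-just nothing f pf = refl
>>=-just (just x) f pf = pf x

_⊆ᵇ_ : ∀ {n} → Subset n → Subset n → Bool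
[] ⊆ᵇ [] = true
(x ∷ X) ⊆ᵇ (v ∷ V) = (not x ∨ v) ∧ (X ⊆ᵇ V)

disjointᵇ : ∀ {n} → Subset n → Subset n → Bool
disjointᵇ [] [] = true
disjointᵇ (a ∷ A) (b ∷ B) = not (a ∧ b) ∧ disjointᵇ A B

∈ᵐ : ∀ {n} → Maybe (Fin n) → Subset n → Bool
∈ᵐ nothing V = true
∈ᵐ (just q) V = lookup V q

allFinᵇ : ∀ n → (Fin n → Bool) → Bool
allFinᵇ zero P = true
allFinᵇ (suc n) P = P zero ∧ allFinᵇ n (λ i → P (suc i))

allᵇ-tabulate : ∀ {A : Set} (p : A → Bool) n (g : Fin n → A) → allᵇ p (List.tabulate g) ≡ allFinᵇ n (λ i → p (g i))
allᵇ-tabulate p zero g = refl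
allᵇ-tabulate p (suc n) g = cong (p (g zero) ∧_) (allᵇ-tabulate p n (λ i → g (suc i)))

allᵇ-map-suc : ∀ {n} (p : Fin (suc n) → Bool) (xs : List (Fin n)) → allᵇ p (List.map suc xs) ≡ allᵇ (λ i → p (suc i)) xs
allᵇ-map-suc p [] = refl
allᵇ-map-suc p (x ∷ xs) = cong (p (suc x) ∧_) (allᵇ-map-suc p xs)

allFinᵇ-cong : ∀ n {P Q : Fin n → Bool} → (∀ i → P i ≡ Q i) → allFinᵇ n P ≡ allFinᵇ n Q
allFinᵇ-cong zero e = refl
allFinᵇ-cong (suc n) e = cong₂ _∧_ (e zero) (allFinᵇ-cong n (λ i → e (suc i)))

allFinᵇ-elim : ∀ n (P : Fin n → Bool) → allFinᵇ n P ≡ true → ∀ i → P i ≡ true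
allFinᵇ-elim (suc n) P e zero with P zero | e
... | true | _ = refl
allFinᵇ-elim (suc n) P e (suc i) with P zero | e
... | true | e' = allFinᵇ-elim n (λ i → P (suc i)) e' i

map-suc->>= : ∀ {a} {B : Set} (x : Maybe (Fin a)) (h : Fin (suc a) → Maybe B) →
              (Maybe.map suc x >>= h) ≡ (x >>= (λ j → h (suc j)))
map-suc->>= nothing h = refl
map-suc->>= (just x) h = refl

>>=-map : ∀ {A B C : Set} (x : Maybe A) (k : A → Maybe B) (s : B → C) →
           (x >>= (λ j → Maybe.map s (k j))) ≡ Maybe.map s (x >>= k)
>>=-map nothing k s = refl
>>=-map (just x) k s = refl

>>=-assoc : ∀ {A B C : Set} (x : Maybe A) (f : A → Maybe B) (g : B → Maybe C) (h : A → Maybe C) →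
             (∀ i → (f i >>= g) ≡ h i) → ((x >>= f) >>= g) ≡ (x >>= h)
>>=-assoc nothing f g h e = refl
>>=-assoc (just x) f g h e = e x

>>=-cong : ∀ {A B : Set} {f g : A → Maybe B} (x : Maybe A) → (∀ i → f i ≡ g i) → (x >>= f) ≡ (x >>= g)
>>=-cong nothing e = refl
>>=-cong (just x) e = e x

map->>=-natural : ∀ {A B C D : Set} (f : A → B) (ρ : B → Maybe C) (g : D → C) (r : A → Maybe D) (x : Maybe A) →
   (∀ v → ρ (f v) ≡ Maybe.map g (r v)) → (Maybe.map f x >>= ρ) ≡ Maybe.map g (x >>= r)
map->>=-natural f ρ g r nothing e = refl
map->>=-natural f ρ g r (just x) e = e x

map-map : ∀ {A B C : Set} (f : A → B) (g : B → C) (x : Maybe A) → Maybe.map g (Maybe.map f x) ≡ Maybe.map (λ a → g (f a)) x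
map-map f g nothing = refl
map-map f g (just x) = refl

map-∘-≗ : ∀ {A B C : Set} (f : A → B) (g : B → C) (h : A → C) (x : Maybe A) → (∀ i → g (f i) ≡ h i) →
           Maybe.map g (Maybe.map f x) ≡ Maybe.map h x
map-∘-≗ f g h nothing e = refl
map-∘-≗ f g h (just x) e = cong just (e x)

map-id : ∀ {n} (p : Maybe (Fin n)) (f : Fin n → Fin n) → (∀ i → f i ≡ i) → Maybe.map f p ≡ p
map-id nothing f e = refl
map-id (just x) f e = cong just (e x)

is-just-map : ∀ {A B : Set} (f : A → B) (x : Maybe A) → is-just (Maybe.map f x) ≡ is-just x
is-just-map f nothing = refl
is-just-map f (just x) = refl

map-suc-just : ∀ {m} (x : Maybe (Fin m)) (y : Fin m) → Maybe.map (Fin.suc {m}) x ≡ just (Fin.suc y) → x ≡ just y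
map-suc-just (just x) y refl = refl

map-suc≢just-zero : ∀ {m} (x : Maybe (Fin m)) → Maybe.map (Fin.suc {m}) x ≡ just (Fin.zero {m}) → ⊥
map-suc≢just-zero nothing ()
map-suc≢just-zero (just x) ()

∈ᵐ-map-suc : ∀ {n} (y : Maybe (Fin n)) b Y → ∈ᵐ (Maybe.map suc y) (b ∷ Y) ≡ ∈ᵐ y Y
∈ᵐ-map-suc nothing b Y = refl
∈ᵐ-map-suc (just x) b Y = refl

∧-projˡ : ∀ a b → a ∧ b ≡ true → a ≡ true
∧-projˡ true b e = refl

∧-projʳ : ∀ a b → a ∧ b ≡ true → b ≡ true
∧-projʳ true b e = e

∧-interchange : ∀ a b c d → (a ∧ b) ∧ (c ∧ d) ≡ (a ∧ c) ∧ (b ∧ d)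
∧-interchange true true c d = refl
∧-interchange true false c d = P.sym (∧-zeroʳ c)
∧-interchange false b c d = refl

∧-swap : ∀ a b c → a ∧ (b ∧ c) ≡ b ∧ (a ∧ c)
∧-swap true true c = refl
∧-swap true false c = refl
∧-swap false true c = refl
∧-swap false false c = refl

not-∨-self : ∀ w → not w ∨ w ≡ true
not-∨-self true = refl
not-∨-self false = refl

infix 7 _≡ᵇ_

_≡ᵇ_ : Bool → Bool → Bool
true ≡ᵇ b = b
false ≡ᵇ b = not b

≡ᵇ⇒≡ : ∀ a b → a ≡ᵇ b ≡ true → b ≡ a
≡ᵇ⇒≡ true true e = refl
≡ᵇ⇒≡ false false e = refl

≡ᵇ-not : ∀ a b → not a ≡ᵇ not b ≡ a ≡ᵇ b
≡ᵇ-not true true = refl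
≡ᵇ-not true false = refl
≡ᵇ-not false true = refl
≡ᵇ-not false false = refl

≡ᵇ-refl : ∀ a → a ≡ᵇ a ≡ true
≡ᵇ-refl true = refl
≡ᵇ-refl false = refl

lookup-∪ : ∀ {n} (A B : Subset n) q → lookup (A ∪ B) q ≡ lookup A q ∨ lookup B q
lookup-∪ (a ∷ A) (b ∷ B) zero = refl
lookup-∪ (a ∷ A) (b ∷ B) (suc q) = lookup-∪ A B q

lookup-∁ : ∀ {n} (A : Subset n) q → lookup (∁ A) q ≡ not (lookup A q)
lookup-∁ (a ∷ A) zero = refl
lookup-∁ (a ∷ A) (suc q) = lookup-∁ A q

∈ᵐ-∪ : ∀ {n} (p : Maybe (Fin n)) V Y → ∈ᵐ p V ≡ true → ∈ᵐ p (V ∪ Y) ≡ true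
∈ᵐ-∪ nothing V Y e = refl
∈ᵐ-∪ (just q) V Y e = P.trans (lookup-∪ V Y q) (cong (_∨ lookup Y q) e)

lookup-extensionality : ∀ {n} {A : Set} (U V : Vec A n) → (∀ i → lookup U i ≡ lookup V i) → U ≡ V
lookup-extensionality [] [] e = refl
lookup-extensionality (u ∷ U) (v ∷ V) e = cong₂ _∷_ (e zero) (lookup-extensionality U V (λ i → e (suc i)))

∩-⊆ᵇ : ∀ {n} (X V : Subset n) → X ⊆ᵇ V ≡ true → V ∩ X ≡ X
∩-⊆ᵇ [] [] e = refl
∩-⊆ᵇ (true ∷ X) (true ∷ V) e = cong (true ∷_) (∩-⊆ᵇ X V e)
∩-⊆ᵇ (false ∷ X) (true ∷ V) e = cong (false ∷_) (∩-⊆ᵇ X V e)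
∩-⊆ᵇ (false ∷ X) (false ∷ V) e = cong (false ∷_) (∩-⊆ᵇ X V e)

⊆ᵇ∁≡disjointᵇ : ∀ {n} (V Y : Subset n) → Y ⊆ᵇ ∁ V ≡ disjointᵇ V Y
⊆ᵇ∁≡disjointᵇ [] [] = refl
⊆ᵇ∁≡disjointᵇ (true ∷ V) (true ∷ Y) = refl
⊆ᵇ∁≡disjointᵇ (true ∷ V) (false ∷ Y) = ⊆ᵇ∁≡disjointᵇ V Y
⊆ᵇ∁≡disjointᵇ (false ∷ V) (true ∷ Y) = ⊆ᵇ∁≡disjointᵇ V Y
⊆ᵇ∁≡disjointᵇ (false ∷ V) (false ∷ Y) = ⊆ᵇ∁≡disjointᵇ V Y

∁∩-disjointᵇ : ∀ {n} (V Y : Subset n) → disjointᵇ V Y ≡ true → ∁ V ∩ Y ≡ Y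
∁∩-disjointᵇ [] [] e = refl
∁∩-disjointᵇ (true ∷ V) (false ∷ Y) e = cong (false ∷_) (∁∩-disjointᵇ V Y e)
∁∩-disjointᵇ (false ∷ V) (true ∷ Y) e = cong (true ∷_) (∁∩-disjointᵇ V Y e)
∁∩-disjointᵇ (false ∷ V) (false ∷ Y) e = cong (false ∷_) (∁∩-disjointᵇ V Y e)

∁∩∁ : ∀ {n} (V Y : Subset n) → ∁ V ∩ ∁ Y ≡ ∁ (V ∪ Y)
∁∩∁ [] [] = refl
∁∩∁ (true ∷ V) (y ∷ Y) = cong (false ∷_) (∁∩∁ V Y)
∁∩∁ (false ∷ V) (y ∷ Y) = cong (not y ∷_) (∁∩∁ V Y)

∪∩∁-disjointᵇ : ∀ {n} (A B : Subset n) → disjointᵇ A B ≡ true → (A ∪ B) ∩ ∁ A ≡ B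
∪∩∁-disjointᵇ [] [] e = refl
∪∩∁-disjointᵇ (true ∷ A) (false ∷ B) e = cong (false ∷_) (∪∩∁-disjointᵇ A B e)
∪∩∁-disjointᵇ (false ∷ A) (true ∷ B) e = cong (true ∷_) (∪∩∁-disjointᵇ A B e)
∪∩∁-disjointᵇ (false ∷ A) (false ∷ B) e = cong (false ∷_) (∪∩∁-disjointᵇ A B e)

∪-∩∁-⊆ᵇ : ∀ {n} (S U : Subset n) → S ⊆ᵇ U ≡ true → S ∪ (U ∩ ∁ S) ≡ U
∪-∩∁-⊆ᵇ [] [] h = refl
∪-∩∁-⊆ᵇ (true ∷ S) (true ∷ U) h = cong (true ∷_) (∪-∩∁-⊆ᵇ S U h)
∪-∩∁-⊆ᵇ (false ∷ S) (true ∷ U) h = cong (true ∷_) (∪-∩∁-⊆ᵇ S U h)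
∪-∩∁-⊆ᵇ (false ∷ S) (false ∷ U) h = cong (false ∷_) (∪-∩∁-⊆ᵇ S U h)

disjointᵇ-∩∁ : ∀ {n} (S U : Subset n) → disjointᵇ S (U ∩ ∁ S) ≡ true
disjointᵇ-∩∁ [] [] = refl
disjointᵇ-∩∁ (true ∷ S) (true ∷ U) = disjointᵇ-∩∁ S U
disjointᵇ-∩∁ (true ∷ S) (false ∷ U) = disjointᵇ-∩∁ S U
disjointᵇ-∩∁ (false ∷ S) (u ∷ U) = disjointᵇ-∩∁ S U

∩-⊇ : ∀ {n} (W B : Subset n) → (∀ v → lookup B v ≡ true → lookup W v ≡ true) → W ∩ B ≡ B
∩-⊇ [] [] h = refl
∩-⊇ (w ∷ W) (true ∷ B) h rewrite h zero refl = cong (true ∷_) (∩-⊇ W B (λ v → h (suc v)))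
∩-⊇ (w ∷ W) (false ∷ B) h = cong₂ _∷_ (∧-zeroʳ w) (∩-⊇ W B (λ v → h (suc v)))

∩-absorb : ∀ {n} (B C S : Subset n) → B ⊆ᵇ C ≡ true → B ∩ (C ∩ S) ≡ B ∩ S
∩-absorb [] [] [] h = refl
∩-absorb (true ∷ B) (true ∷ C) (s ∷ S) h = cong (s ∷_) (∩-absorb B C S h)
∩-absorb (false ∷ B) (c ∷ C) (s ∷ S) h = cong (false ∷_) (∩-absorb B C S h)

nonEmpty-witness : ∀ {n} (S : Subset n) → isEmptyᵇ S ≡ false → Σ (Fin n) (λ v → lookup S v ≡ true)
nonEmpty-witness (true ∷ S) e = zero , refl
nonEmpty-witness (false ∷ S) e with nonEmpty-witness S e
... | v , ev = suc v , ev

⊈ᵇ-witness : ∀ {n} (S U : Subset n) → S ⊆ᵇ U ≡ false → Σ (Fin n) (λ v → (lookup S v ≡ true) × (lookup U v ≡ false))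
⊈ᵇ-witness [] [] ()
⊈ᵇ-witness (true ∷ S) (false ∷ U) h = zero , refl , refl
⊈ᵇ-witness (true ∷ S) (true ∷ U) h with ⊈ᵇ-witness S U h
... | v , a , b = suc v , a , b
⊈ᵇ-witness (false ∷ S) (u ∷ U) h with ⊈ᵇ-witness S U h
... | v , a , b = suc v , a , b

⊆ᵇ∅-nonEmpty : ∀ {n} (S : Subset n) → isEmptyᵇ S ≡ false → S ⊆ᵇ replicate n false ≡ false
⊆ᵇ∅-nonEmpty (true ∷ S) e = refl
⊆ᵇ∅-nonEmpty (false ∷ S) e = ⊆ᵇ∅-nonEmpty S e

∅⊆ᵇ∅ : ∀ n → replicate n false ⊆ᵇ replicate n false ≡ true
∅⊆ᵇ∅ zero = refl
∅⊆ᵇ∅ (suc n) = ∅⊆ᵇ∅ n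

⊆ᵇ-∪ˡ : ∀ {n} (A X : Subset n) → A ⊆ᵇ (A ∪ X) ≡ true
⊆ᵇ-∪ˡ [] [] = refl
⊆ᵇ-∪ˡ (true ∷ A) (x ∷ X) = ⊆ᵇ-∪ˡ A X
⊆ᵇ-∪ˡ (false ∷ A) (x ∷ X) = ⊆ᵇ-∪ˡ A X

⊆ᵇ-∪ʳ : ∀ {n} (B A X : Subset n) → B ⊆ᵇ X ≡ true → B ⊆ᵇ (A ∪ X) ≡ true
⊆ᵇ-∪ʳ [] [] [] h = refl
⊆ᵇ-∪ʳ (true ∷ B) (a ∷ A) (true ∷ X) h rewrite ∨-zeroʳ a = ⊆ᵇ-∪ʳ B A X h
⊆ᵇ-∪ʳ (false ∷ B) (a ∷ A) (x ∷ X) h = ⊆ᵇ-∪ʳ B A X h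

⊆ᵇ-full : ∀ {n} (S C : Subset n) → (∀ v → lookup C v ≡ true) → S ⊆ᵇ C ≡ true
⊆ᵇ-full [] [] h = refl
⊆ᵇ-full (s ∷ S) (c ∷ C) h rewrite h zero | ∨-zeroʳ (not s) = ⊆ᵇ-full S C (λ v → h (suc v))

disjointᵇ-lookup : ∀ {n} (A C : Subset n) → (∀ v → lookup A v ≡ true → lookup C v ≡ false) → disjointᵇ A C ≡ true
disjointᵇ-lookup [] [] h = refl
disjointᵇ-lookup (true ∷ A) (c ∷ C) h rewrite h zero refl = disjointᵇ-lookup A C (λ v → h (suc v))
disjointᵇ-lookup (false ∷ A) (c ∷ C) h = disjointᵇ-lookup A C (λ v → h (suc v))

⋃ : ∀ {n} m → (Fin m → Subset n) → Subset n
⋃ {n} zero B = replicate n false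
⋃ (suc m) B = B zero ∪ ⋃ m (λ k → B (suc k))

⊆ᵇ-⋃ : ∀ {n} m (B : Fin m → Subset n) k → B k ⊆ᵇ ⋃ m B ≡ true
⊆ᵇ-⋃ (suc m) B zero = ⊆ᵇ-∪ˡ (B zero) _
⊆ᵇ-⋃ (suc m) B (suc k) = ⊆ᵇ-∪ʳ (B (suc k)) (B zero) _ (⊆ᵇ-⋃ m (λ k → B (suc k)) k)

∈-⋃⁻ : ∀ {n} m (B : Fin m → Subset n) v → lookup (⋃ m B) v ≡ true → Σ (Fin m) (λ k → lookup (B k) v ≡ true)
∈-⋃⁻ zero B v e rewrite lookup-replicate v false with e
... | ()
∈-⋃⁻ (suc m) B v e with lookup (B zero) v in e0
... | true = zero , e0
... | false with ∈-⋃⁻ m (λ k → B (suc k)) v (P.trans (P.sym (cong (_∨ lookup (⋃ m (λ k → B (suc k))) v) e0)) (P.trans (P.sym (lookup-∪ (B zero) _ v)) e))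
...   | k , ek = suc k , ek

∈-⋃⁺ : ∀ {n} m (B : Fin m → Subset n) k v → lookup (B k) v ≡ true → lookup (⋃ m B) v ≡ true
∈-⋃⁺ (suc m) B zero v e = P.trans (lookup-∪ (B zero) _ v) (cong (_∨ lookup (⋃ m (λ k → B (suc k))) v) e)
∈-⋃⁺ (suc m) B (suc k) v e =
  P.trans (lookup-∪ (B zero) _ v) (P.trans (cong (lookup (B zero) v ∨_) (∈-⋃⁺ m (λ k → B (suc k)) k v e)) (∨-zeroʳ _))

≟-refl : ∀ {m} (j : Fin m) → does (j ≟ j) ≡ true
≟-refl j = dec-true (j ≟ j) refl

does-≟⇒≡ : ∀ {m} {a b : Fin m} → does (a ≟ b) ≡ true → a ≡ b
does-≟⇒≡ {a = a} {b} e with a ≟ b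
... | yes p = p

does-≟-cong : ∀ {m k} {a b : Fin m} {c d : Fin k} → (a ≡ b → c ≡ d) → (c ≡ d → a ≡ b) → does (a ≟ b) ≡ does (c ≟ d)
does-≟-cong {a = a} {b} {c} {d} f g with c ≟ d
... | yes c≡d = dec-true (a ≟ b) (g c≡d)
... | no c≢d = dec-false (a ≟ b) (λ a≡b → c≢d (f a≡b))

module _ {o} {Ω : Set o} where

  size∣ : ∀ {n} → Forest Ω n → Subset n → ℕ
  size∣ F V = proj₁ (restrict F V)

  forest∣ : ∀ {n} (F : Forest Ω n) V → Forest Ω (size∣ F V)
  forest∣ F V = proj₁ (proj₂ (restrict F V))

  embed∣ : ∀ {n} (F : Forest Ω n) V → Fin n → Maybe (Fin (size∣ F V))
  embed∣ F V = proj₂ (proj₂ (restrict F V))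

  shrink∣ : ∀ {n} (F : Forest Ω n) (V Z : Subset n) → Subset (size∣ F V)
  shrink∣ ∅ [] [] = []
  shrink∣ (node ω p F) (true ∷ V) (z ∷ Z) = z ∷ shrink∣ F V Z
  shrink∣ (node ω p F) (false ∷ V) (z ∷ Z) = shrink∣ F V Z

  size∣-∅ : ∀ {n} (F : Forest Ω n) → size∣ F (replicate n false) ≡ 0
  size∣-∅ ∅ = refl
  size∣-∅ (node ω p F) = size∣-∅ F

  size∣-nonempty : ∀ {n} (F : Forest Ω n) V → isEmptyᵇ V ≡ false → Σ ℕ (λ k → size∣ F V ≡ suc k)
  size∣-nonempty (node ω p F) (true ∷ V) e = _ , refl
  size∣-nonempty (node ω p F) (false ∷ V) e = size∣-nonempty F V e

  size∣-≥1 : ∀ {n} (F : Forest Ω n) B v → lookup B v ≡ true → Σ ℕ (λ k → size∣ F B ≡ suc k)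
  size∣-≥1 (node ω p F) (true ∷ B) v e = _ , refl
  size∣-≥1 (node ω p F) (false ∷ B) (suc v) e = size∣-≥1 F B v e

  size∣-≥2 : ∀ {n} (F : Forest Ω n) B u v → lookup B u ≡ true → lookup B v ≡ true → ¬ (u ≡ v) → Σ ℕ (λ k → size∣ F B ≡ suc (suc k))
  size∣-≥2 (node ω p F) (b ∷ B) zero zero eu ev ne with ne refl
  ... | ()
  size∣-≥2 (node ω p F) (true ∷ B) zero (suc v) eu ev ne with size∣-≥1 F B v ev
  ... | k , e = k , cong suc e
  size∣-≥2 (node ω p F) (true ∷ B) (suc u) zero eu ev ne with size∣-≥1 F B u eu
  ... | k , e = k , cong suc e
  size∣-≥2 (node ω p F) (true ∷ B) (suc u) (suc v) eu ev ne with size∣-≥2 F B u v eu ev (λ x → ne (cong suc x))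
  ... | k , e = suc k , cong suc e
  size∣-≥2 (node ω p F) (false ∷ B) (suc u) (suc v) eu ev ne = size∣-≥2 F B u v eu ev (λ x → ne (cong suc x))

  size∣-≡0 : ∀ {n} (F : Forest Ω n) B → (∀ v → lookup B v ≡ false) → size∣ F B ≡ 0
  size∣-≡0 ∅ [] e = refl
  size∣-≡0 (node ω p F) (true ∷ B) e with e zero
  ... | ()
  size∣-≡0 (node ω p F) (false ∷ B) e = size∣-≡0 F B (λ v → e (suc v))

  size∣-singleton : ∀ {n} (F : Forest Ω n) B j → (∀ v → lookup B v ≡ does (v ≟ j)) → size∣ F B ≡ 1
  size∣-singleton (node ω p F) (true ∷ B) zero e = cong suc (size∣-≡0 F B (λ v → e (suc v)))
  size∣-singleton (node ω p F) (false ∷ B) zero e with e zero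
  ... | ()
  size∣-singleton (node ω p F) (true ∷ B) (suc j) e with e zero
  ... | ()
  size∣-singleton (node ω p F) (false ∷ B) (suc j) e = size∣-singleton F B j (λ v → e (suc v))

  restrict-full : ∀ {n} (F : Forest Ω n) →
     Σ (Fin n → Maybe (Fin n)) (λ f → (restrict F (replicate n true) ≡ (n , F , f)) × (∀ i → f i ≡ just i))
  restrict-full ∅ = _ , refl , λ ()
  restrict-full {suc n} (node ω p F) with restrict F (replicate n true) | restrict-full F
  ... | .(n , F , f) | f , refl , pf rewrite >>=-just p f pf = _ , refl , λ { zero → refl ; (suc i) → cong (Maybe.map suc) (pf i) }

  ∣-full : ∀ {n} (F : Forest Ω n) → F ∣ replicate n true ≡ (n , F)
  ∣-full {n} F with restrict F (replicate n true) | restrict-full F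
  ... | .(n , F , f) | f , refl , _ = refl

  ancestors-suc : ∀ {n} {ω : Ω} (p : Maybe (Fin n)) (F : Forest Ω n) i → ancestors (node ω p F) (suc i) ≡ List.map suc (ancestors F i)
  ancestors-suc nothing F i = refl
  ancestors-suc (just x) F i = refl

  downClosedᵇ : ∀ {n} → Forest Ω n → Subset n → Bool
  downClosedᵇ ∅ [] = true
  downClosedᵇ (node ω p F) (b ∷ V) = (not b ∨ ∈ᵐ p V) ∧ downClosedᵇ F V

  productAdmissible-ancestors : ∀ {n} (F : Forest Ω n) V q → productAdmissible F V ≡ true → lookup V q ≡ true →
            allᵇ (lookup V) (ancestors F q) ≡ true
  productAdmissible-ancestors {n} F V q e vq with allFinᵇ-elim n _ (P.trans (P.sym (allᵇ-tabulate _ n (λ i → i))) e) q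
  ... | r rewrite vq = r

  productAdmissible≡downClosedᵇ : ∀ {n} (F : Forest Ω n) V → productAdmissible F V ≡ downClosedᵇ F V
  productAdmissible≡downClosedᵇ ∅ [] = refl
  productAdmissible≡downClosedᵇ {suc n} (node ω p F) (b ∷ V) =
    P.trans (cong (root-condition ∧_) (P.trans (allᵇ-tabulate _ n suc)
              (P.trans (allFinᵇ-cong n (λ i → cong (λ z → not (lookup V i) ∨ z) (P.trans (cong (allᵇ (lookup (b ∷ V))) (ancestors-suc p F i)) (allᵇ-map-suc (lookup (b ∷ V)) (ancestors F i)))))
                       (P.sym (allᵇ-tabulate _ n (λ i → i))))))
    (P.trans (root-condition≡ p) (cong ((not b ∨ ∈ᵐ p V) ∧_) (productAdmissible≡downClosedᵇ F V)))
    where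
      root-condition = not b ∨ allᵇ (lookup (b ∷ V)) (ancestors (node ω p F) zero)
      root-condition≡ : ∀ p → (not b ∨ allᵇ (lookup (b ∷ V)) (ancestors (node ω p F) zero)) ∧ productAdmissible F V
                   ≡ (not b ∨ ∈ᵐ p V) ∧ productAdmissible F V
      root-condition≡ nothing = refl
      root-condition≡ (just q) rewrite allᵇ-map-suc (lookup (b ∷ V)) (ancestors F q) with productAdmissible F V in eA
      ... | false = P.trans (∧-zeroʳ _) (P.sym (∧-zeroʳ _))
      ... | true with lookup V q in eq
      ...   | false = refl
      ...   | true rewrite productAdmissible-ancestors F V q eA eq = refl

  productAdmissible-∅ : ∀ {n} (F : Forest Ω n) → productAdmissible F (replicate n false) ≡ true
  productAdmissible-∅ {n} F = allᵇ-true _ (allFin n) (λ v → P.subst (λ b → not b ∨ allᵇ (λ u → lookup (replicate n false) u) (ancestors F v) ≡ true) (P.sym (lookup-replicate v false)) refl)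

  productAdmissible-full : ∀ {n} (F : Forest Ω n) → productAdmissible F (replicate n true) ≡ true
  productAdmissible-full {n} F = allᵇ-true _ (allFin n) (λ v →
     P.trans (cong (λ b → not b ∨ allᵇ (λ u → lookup (replicate n true) u) (ancestors F v)) (lookup-replicate v true))
             (allᵇ-true _ (ancestors F v) (λ u → lookup-replicate u true)))

  RestrictResult : ℕ → Set o
  RestrictResult n = Σ ℕ (λ m → Σ (Forest Ω m) (λ _ → Fin n → Maybe (Fin m)))

  _∘ʳ_ : ∀ {n} (r : RestrictResult n) → RestrictResult (proj₁ r) → RestrictResult n
  _∘ʳ_ (m , G , f) (k , H , g) = (k , H , λ i → f i >>= g)

  data SameRestriction {n} : RestrictResult n → RestrictResult n → Set o where
    sameRestriction : ∀ {m G f g} → (∀ i → f i ≡ g i) → SameRestriction (m , G , f) (m , G , g)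

  sameRestriction-cong : ∀ {n m} {G G' : Forest Ω m} {f g : Fin n → Maybe (Fin m)} → G ≡ G' → (∀ i → f i ≡ g i) →
             SameRestriction (m , G , f) (m , G' , g)
  sameRestriction-cong refl e = sameRestriction e

  sameRestriction-forest : ∀ {n} {r s : RestrictResult n} → SameRestriction r s → _≡_ {A = Σ ℕ (Forest Ω)} (proj₁ r , proj₁ (proj₂ r)) (proj₁ s , proj₁ (proj₂ s))
  sameRestriction-forest (sameRestriction _) = refl

  restrict-restrict : ∀ {n} (F : Forest Ω n) V Z → SameRestriction (_∘ʳ_ (restrict F V) (restrict (forest∣ F V) (shrink∣ F V Z))) (restrict F (V ∩ Z))
  restrict-restrict ∅ [] [] = sameRestriction (λ ())
  restrict-restrict (node ω p F) (true ∷ V) (true ∷ Z) with restrict F (V ∩ Z) | restrict (forest∣ F V) (shrink∣ F V Z) | restrict-restrict F V Z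
  ... | _ | k , G , f2 | sameRestriction pf =
    sameRestriction-cong (cong (λ x → node ω x G) (>>=-assoc p (embed∣ F V) f2 _ pf))
             (λ { zero → refl ; (suc i) → P.trans (map-suc->>= (embed∣ F V i) _) (P.trans (>>=-map (embed∣ F V i) f2 suc) (cong (Maybe.map suc) (pf i))) })
  restrict-restrict (node ω p F) (true ∷ V) (false ∷ Z) with restrict F (V ∩ Z) | restrict (forest∣ F V) (shrink∣ F V Z) | restrict-restrict F V Z
  ... | _ | k , G , f2 | sameRestriction pf =
    sameRestriction (λ { zero → refl ; (suc i) → P.trans (map-suc->>= (embed∣ F V i) _) (pf i) })
  restrict-restrict (node ω p F) (false ∷ V) (z ∷ Z) with restrict F (V ∩ Z) | restrict (forest∣ F V) (shrink∣ F V Z) | restrict-restrict F V Z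
  ... | _ | k , G , f2 | sameRestriction pf =
    sameRestriction (λ { zero → refl ; (suc i) → pf i })

  ∣-∣ : ∀ {n} (F : Forest Ω n) V Z → (forest∣ F V ∣ shrink∣ F V Z) ≡ (F ∣ (V ∩ Z))
  ∣-∣ F V Z = sameRestriction-forest (restrict-restrict F V Z)

  embed∣-outside : ∀ {n} (F : Forest Ω n) W q → lookup W q ≡ false → embed∣ F W q ≡ nothing
  embed∣-outside (node ω p F) (false ∷ W) zero e = refl
  embed∣-outside (node ω p F) (true ∷ W) (suc q) e = cong (Maybe.map suc) (embed∣-outside F W q e)
  embed∣-outside (node ω p F) (false ∷ W) (suc q) e = embed∣-outside F W q e

  embed∣-inside : ∀ {n} (F : Forest Ω n) W q → lookup W q ≡ true → Σ (Fin (size∣ F W)) (λ j → embed∣ F W q ≡ just j)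
  embed∣-inside (node ω p F) (true ∷ W) zero e = zero , refl
  embed∣-inside (node ω p F) (true ∷ W) (suc q) e with embed∣-inside F W q e
  ... | j , ej = suc j , cong (Maybe.map suc) ej
  embed∣-inside (node ω p F) (false ∷ W) (suc q) e = embed∣-inside F W q e

  embed∣-surjective : ∀ {n} (F : Forest Ω n) W (x : Fin (size∣ F W)) → Σ (Fin n) (λ v → embed∣ F W v ≡ just x)
  embed∣-surjective ∅ [] ()
  embed∣-surjective (node ω p F) (true ∷ W) zero = zero , refl
  embed∣-surjective (node ω p F) (true ∷ W) (suc x) with embed∣-surjective F W x
  ... | v , e = suc v , cong (Maybe.map suc) e
  embed∣-surjective (node ω p F) (false ∷ W) x with embed∣-surjective F W x
  ... | v , e = suc v , e

  embed∣-injective : ∀ {n} (F : Forest Ω n) W a b c → embed∣ F W a ≡ just c → embed∣ F W b ≡ just c → a ≡ b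
  embed∣-injective (node ω p F) (true ∷ W) zero zero c ea eb = refl
  embed∣-injective (node ω p F) (true ∷ W) zero (suc b) c ea eb with P.trans eb (P.sym ea)
  ... | e = ⊥-elim (map-suc≢just-zero (embed∣ F W b) e)
  embed∣-injective (node ω p F) (true ∷ W) (suc a) zero c ea eb with P.trans ea (P.sym eb)
  ... | e = ⊥-elim (map-suc≢just-zero (embed∣ F W a) e)
  embed∣-injective (node ω p F) (true ∷ W) (suc a) (suc b) zero ea eb = ⊥-elim (map-suc≢just-zero (embed∣ F W a) ea)
  embed∣-injective (node ω p F) (true ∷ W) (suc a) (suc b) (suc c) ea eb =
    cong suc (embed∣-injective F W a b c (map-suc-just (embed∣ F W a) c ea) (map-suc-just (embed∣ F W b) c eb))
  embed∣-injective (node ω p F) (false ∷ W) (suc a) (suc b) c ea eb = cong suc (embed∣-injective F W a b c ea eb)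

  is-just-embed∣ : ∀ {n} (F : Forest Ω n) W q → is-just (embed∣ F W q) ≡ lookup W q
  is-just-embed∣ (node ω p F) (true ∷ W) zero = refl
  is-just-embed∣ (node ω p F) (true ∷ W) (suc q) = P.trans (is-just-map suc (embed∣ F W q)) (is-just-embed∣ F W q)
  is-just-embed∣ (node ω p F) (false ∷ W) zero = refl
  is-just-embed∣ (node ω p F) (false ∷ W) (suc q) = is-just-embed∣ F W q

  lookup-shrink∣ : ∀ {n} (F : Forest Ω n) W Z v x → embed∣ F W v ≡ just x → lookup (shrink∣ F W Z) x ≡ lookup Z v
  lookup-shrink∣ (node ω p F) (true ∷ W) (z ∷ Z) zero .zero refl = refl
  lookup-shrink∣ (node ω p F) (true ∷ W) (z ∷ Z) (suc v) zero e = ⊥-elim (map-suc≢just-zero (embed∣ F W v) e)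
  lookup-shrink∣ (node ω p F) (true ∷ W) (z ∷ Z) (suc v) (suc x) e = lookup-shrink∣ F W Z v x (map-suc-just (embed∣ F W v) x e)
  lookup-shrink∣ (node ω p F) (false ∷ W) (z ∷ Z) (suc v) x e = lookup-shrink∣ F W Z v x e

  shrink∣-∩ : ∀ {n} (F : Forest Ω n) W S → shrink∣ F W (W ∩ S) ≡ shrink∣ F W S
  shrink∣-∩ ∅ [] [] = refl
  shrink∣-∩ (node ω p F) (true ∷ W) (s ∷ S) = cong (s ∷_) (shrink∣-∩ F W S)
  shrink∣-∩ (node ω p F) (false ∷ W) (s ∷ S) = shrink∣-∩ F W S

  ∁-shrink∣ : ∀ {n} (F : Forest Ω n) V X → ∁ (shrink∣ F V X) ≡ shrink∣ F V (∁ X)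
  ∁-shrink∣ ∅ [] [] = refl
  ∁-shrink∣ (node ω p F) (true ∷ V) (x ∷ X) = cong (not x ∷_) (∁-shrink∣ F V X)
  ∁-shrink∣ (node ω p F) (false ∷ V) (x ∷ X) = ∁-shrink∣ F V X

  parentOf-embed∣ : ∀ {n} (F : Forest Ω n) W v x → embed∣ F W v ≡ just x → parentOf (forest∣ F W) x ≡ (parentOf F v >>= embed∣ F W)
  parentOf-embed∣ (node ω p F) (true ∷ W) zero .zero refl =
    P.sym (P.trans (map-suc->>= p _) (>>=-map p (embed∣ F W) suc))
  parentOf-embed∣ (node ω p F) (true ∷ W) (suc v) zero e = ⊥-elim (map-suc≢just-zero (embed∣ F W v) e)
  parentOf-embed∣ (node ω p F) (true ∷ W) (suc v) (suc x) e =
    P.trans (cong (Maybe.map suc) (parentOf-embed∣ F W v x (map-suc-just (embed∣ F W v) x e)))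
            (P.sym (P.trans (map-suc->>= (parentOf F v) _) (>>=-map (parentOf F v) (embed∣ F W) suc)))
  parentOf-embed∣ (node ω p F) (false ∷ W) (suc v) x e =
    P.trans (parentOf-embed∣ F W v x e) (P.sym (map-suc->>= (parentOf F v) _))

  ∈ᵐ-embed∣ : ∀ {n} (F : Forest Ω n) V X q → ∈ᵐ (embed∣ F V q) (shrink∣ F V X) ≡ not (lookup V q) ∨ lookup X q
  ∈ᵐ-embed∣ (node ω p F) (true ∷ V) (x ∷ X) zero = refl
  ∈ᵐ-embed∣ (node ω p F) (true ∷ V) (x ∷ X) (suc q) = P.trans (∈ᵐ-map-suc (embed∣ F V q) x _) (∈ᵐ-embed∣ F V X q)
  ∈ᵐ-embed∣ (node ω p F) (false ∷ V) (x ∷ X) zero = refl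
  ∈ᵐ-embed∣ (node ω p F) (false ∷ V) (x ∷ X) (suc q) = ∈ᵐ-embed∣ F V X q

  downClosedᵇ-restrict-⊆ : ∀ {n} (F : Forest Ω n) V X → X ⊆ᵇ V ≡ true → downClosedᵇ F V ≡ true → downClosedᵇ (forest∣ F V) (shrink∣ F V X) ≡ downClosedᵇ F X
  downClosedᵇ-restrict-⊆ ∅ [] [] e h = refl
  downClosedᵇ-restrict-⊆ (node ω nothing F) (true ∷ V) (false ∷ X) e h = downClosedᵇ-restrict-⊆ F V X e h
  downClosedᵇ-restrict-⊆ (node ω (just q) F) (true ∷ V) (false ∷ X) e h = downClosedᵇ-restrict-⊆ F V X e (∧-projʳ (lookup V q) (downClosedᵇ F V) h)
  downClosedᵇ-restrict-⊆ (node ω nothing F) (true ∷ V) (true ∷ X) e h = downClosedᵇ-restrict-⊆ F V X e h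
  downClosedᵇ-restrict-⊆ (node ω (just q) F) (true ∷ V) (true ∷ X) e h =
    cong₂ _∧_ (P.trans (∈ᵐ-embed∣ F V X q) (cong (λ b → not b ∨ lookup X q) (∧-projˡ (lookup V q) (downClosedᵇ F V) h)))
              (downClosedᵇ-restrict-⊆ F V X e (∧-projʳ (lookup V q) (downClosedᵇ F V) h))
  downClosedᵇ-restrict-⊆ (node ω p F) (false ∷ V) (false ∷ X) e h = downClosedᵇ-restrict-⊆ F V X e h
  downClosedᵇ-restrict-⊆ (node ω p F) (false ∷ V) (true ∷ X) () h

  downClosedᵇ-restrict-∁ : ∀ {n} (F : Forest Ω n) V Y → disjointᵇ V Y ≡ true → downClosedᵇ F V ≡ true → downClosedᵇ (forest∣ F (∁ V)) (shrink∣ F (∁ V) Y) ≡ downClosedᵇ F (V ∪ Y)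
  downClosedᵇ-restrict-∁ ∅ [] [] e h = refl
  downClosedᵇ-restrict-∁ (node ω p F) (true ∷ V) (false ∷ Y) e h =
    P.trans (downClosedᵇ-restrict-∁ F V Y e (∧-projʳ (∈ᵐ p V) (downClosedᵇ F V) h))
            (cong (_∧ downClosedᵇ F (V ∪ Y)) (P.sym (∈ᵐ-∪ p V Y (∧-projˡ (∈ᵐ p V) (downClosedᵇ F V) h))))
  downClosedᵇ-restrict-∁ (node ω p F) (true ∷ V) (true ∷ Y) () h
  downClosedᵇ-restrict-∁ (node ω p F) (false ∷ V) (false ∷ Y) e h = downClosedᵇ-restrict-∁ F V Y e h
  downClosedᵇ-restrict-∁ (node ω nothing F) (false ∷ V) (true ∷ Y) e h = downClosedᵇ-restrict-∁ F V Y e h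
  downClosedᵇ-restrict-∁ (node ω (just q) F) (false ∷ V) (true ∷ Y) e h =
    cong₂ _∧_ (P.trans (∈ᵐ-embed∣ F (∁ V) Y q)
                 (P.trans (cong (λ b → not b ∨ lookup Y q) (lookup-∁ V q))
                    (P.trans (cong (_∨ lookup Y q) (not-involutive (lookup V q))) (P.sym (lookup-∪ V Y q)))))
              (downClosedᵇ-restrict-∁ F V Y e h)

module QuotientProperties {o} {Ω : Set o} (_⊕_ : Ω → Ω → Ω) where
  open Quotient {Ω = Ω} _⊕_

  size/ : ∀ {n} → Forest Ω n → Subset n → ℕ
  size/ F S = proj₁ (quotient F S)

  forest/ : ∀ {n} (F : Forest Ω n) S → Forest Ω (size/ F S)
  forest/ F S = proj₁ (proj₂ (quotient F S))

  block/ : ∀ {n} (F : Forest Ω n) S → Fin n → Fin (size/ F S)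
  block/ F S = proj₂ (proj₂ (quotient F S))

  -- The vertices whose parent edge is not kept by S, i.e. the tops of the blocks;
  -- they are the vertices of F/S, in the same order.
  heads : ∀ {n} → Forest Ω n → Subset n → Subset n
  heads ∅ [] = []
  heads (node ω p F) (false ∷ S) = true ∷ heads F S
  heads (node ω (just q) F) (true ∷ S) = false ∷ heads F S
  heads (node ω nothing F) (true ∷ S) = true ∷ heads F S

  -- X read on the heads, as a subset of the vertices of F/S.
  shrink/ : ∀ {n} (F : Forest Ω n) (S X : Subset n) → Subset (size/ F S)
  shrink/ ∅ [] [] = []
  shrink/ (node ω p F) (false ∷ S) (x ∷ X) = x ∷ shrink/ F S X
  shrink/ (node ω (just q) F) (true ∷ S) (x ∷ X) = shrink/ F S X
  shrink/ (node ω nothing F) (true ∷ S) (x ∷ X) = x ∷ shrink/ F S X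

  lookup-blockOf : ∀ {n m} (f : Fin n → Fin m) j v → lookup (blockOf f j) v ≡ does (f v ≟ j)
  lookup-blockOf f j v = lookup∘tabulate (λ w → does (f w ≟ j)) v

  coverᵇ : ∀ {n} → Forest Ω n → Subset n → Bool
  coverᵇ ∅ [] = true
  coverᵇ (node ω p F) (s ∷ S) = (not s ∨ is-just p) ∧ coverᵇ F S

  coverAdmissible≡coverᵇ : ∀ {n} (F : Forest Ω n) S → coverAdmissible F S ≡ coverᵇ F S
  coverAdmissible≡coverᵇ ∅ [] = refl
  coverAdmissible≡coverᵇ {suc n} (node ω p F) (s ∷ S) =
    cong₂ _∧_ (cong (λ b → not s ∨ b) (is-just-map suc p))
      (P.trans (allᵇ-tabulate _ n suc)
        (P.trans (allFinᵇ-cong n (λ i → cong (λ b → not (lookup S i) ∨ b) (is-just-map suc (parentOf F i))))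
          (P.trans (P.sym (allᵇ-tabulate _ n (λ i → i))) (coverAdmissible≡coverᵇ F S))))

  coverᵇ-∅ : ∀ {n} (F : Forest Ω n) → coverᵇ F (replicate n false) ≡ true
  coverᵇ-∅ ∅ = refl
  coverᵇ-∅ (node ω p F) = coverᵇ-∅ F

  coverᵇ-⊆ᵇ : ∀ {n} (F : Forest Ω n) S U → S ⊆ᵇ U ≡ true → coverᵇ F U ≡ true → coverᵇ F S ≡ true
  coverᵇ-⊆ᵇ ∅ [] [] h c = refl
  coverᵇ-⊆ᵇ (node ω p F) (false ∷ S) (u ∷ U) h c = coverᵇ-⊆ᵇ F S U h (∧-projʳ (not u ∨ is-just p) (coverᵇ F U) c)
  coverᵇ-⊆ᵇ (node ω p F) (true ∷ S) (true ∷ U) h c =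
    cong₂ _∧_ (∧-projˡ (is-just p) (coverᵇ F U) c) (coverᵇ-⊆ᵇ F S U h (∧-projʳ (is-just p) (coverᵇ F U) c))

  coverᵇ-∪ : ∀ {n} (F : Forest Ω n) S X → coverᵇ F (S ∪ X) ≡ coverᵇ F S ∧ coverᵇ F X
  coverᵇ-∪ ∅ [] [] = refl
  coverᵇ-∪ (node ω p F) (s ∷ S) (x ∷ X) =
    P.trans (cong₂ _∧_ (edge-condition s x (is-just p)) (coverᵇ-∪ F S X)) (∧-interchange (not s ∨ is-just p) (not x ∨ is-just p) (coverᵇ F S) (coverᵇ F X))
    where
      edge-condition : ∀ s x j → (not (s ∨ x) ∨ j) ≡ (not s ∨ j) ∧ (not x ∨ j)
      edge-condition true true j = P.sym (∧-idem j)
      edge-condition true false j = P.sym (∧-identityʳ j)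
      edge-condition false true j = refl
      edge-condition false false j = refl

  coverᵇ-addDeco : ∀ {m} (G : Forest Ω m) j α Y → coverᵇ (addDeco G j α) Y ≡ coverᵇ G Y
  coverᵇ-addDeco (node ω p G) zero α (y ∷ Y) = refl
  coverᵇ-addDeco (node ω p G) (suc j) α (y ∷ Y) = cong ((not y ∨ is-just p) ∧_) (coverᵇ-addDeco G j α Y)

  coverᵇ-parent : ∀ {n} (G : Forest Ω n) Z x → coverᵇ G Z ≡ true → lookup Z x ≡ true → is-just (parentOf G x) ≡ true
  coverᵇ-parent (node ω p G) (true ∷ Z) zero c e = P.trans (is-just-map suc p) (∧-projˡ (is-just p) (coverᵇ G Z) c)
  coverᵇ-parent (node ω p G) (z ∷ Z) (suc x) c e =
    P.trans (is-just-map suc (parentOf G x)) (coverᵇ-parent G Z x (∧-projʳ (not z ∨ is-just p) (coverᵇ G Z) c) e)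

  blockmate : ∀ {n} (F : Forest Ω n) S v → coverᵇ F S ≡ true → lookup S v ≡ true →
       Σ (Fin n) (λ u → (block/ F S v ≡ block/ F S u) × ¬ (u ≡ v))
  blockmate (node ω (just q) F) (true ∷ S) zero c e = suc q , refl , λ ()
  blockmate (node ω nothing F) (true ∷ S) v () e
  blockmate (node ω (just q) F) (true ∷ S) (suc v) c e with blockmate F S v c e
  ... | u , eq , ne = suc u , eq , λ x → ne (FinP.suc-injective x)
  blockmate (node ω p F) (false ∷ S) (suc v) c e with blockmate F S v c e
  ... | u , eq , ne = suc u , cong suc eq , λ x → ne (FinP.suc-injective x)

  cut-edge-separates : ∀ {n} (F : Forest Ω n) U v u → lookup U v ≡ false → parentOf F v ≡ just u → ¬ (block/ F U u ≡ block/ F U v)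
  cut-edge-separates (node ω (just q) F) (false ∷ U) zero .(suc q) e refl ()
  cut-edge-separates (node ω nothing F) (false ∷ U) zero u e ()
  cut-edge-separates (node ω p F) (false ∷ U) (suc v) zero e pe with parentOf F v
  cut-edge-separates (node ω p F) (false ∷ U) (suc v) zero e () | nothing
  cut-edge-separates (node ω p F) (false ∷ U) (suc v) zero e () | just _
  cut-edge-separates (node ω p F) (false ∷ U) (suc v) (suc u) e pe eq =
    cut-edge-separates F U v u e (map-suc-just (parentOf F v) u pe) (FinP.suc-injective eq)
  cut-edge-separates (node ω nothing F) (true ∷ U) (suc v) zero e pe with parentOf F v
  cut-edge-separates (node ω nothing F) (true ∷ U) (suc v) zero e () | nothing
  cut-edge-separates (node ω nothing F) (true ∷ U) (suc v) zero e () | just _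
  cut-edge-separates (node ω nothing F) (true ∷ U) (suc v) (suc u) e pe eq =
    cut-edge-separates F U v u e (map-suc-just (parentOf F v) u pe) (FinP.suc-injective eq)
  cut-edge-separates (node ω (just q) F) (true ∷ U) (suc v) zero e pe with parentOf F v
  cut-edge-separates (node ω (just q) F) (true ∷ U) (suc v) zero e () | nothing
  cut-edge-separates (node ω (just q) F) (true ∷ U) (suc v) zero e () | just _
  cut-edge-separates (node ω (just q) F) (true ∷ U) (suc v) (suc u) e pe eq =
    cut-edge-separates F U v u e (map-suc-just (parentOf F v) u pe) eq

  QuotientResult : ℕ → Set o
  QuotientResult n = Σ ℕ (λ m → Σ (Forest Ω m) (λ _ → Fin n → Fin m))

  quotient-∅ : ∀ {n} (F : Forest Ω n) →
     Σ (Fin n → Fin n) (λ f → (quotient F (replicate n false) ≡ (n , F , f)) × (∀ i → f i ≡ i))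
  quotient-∅ ∅ = _ , refl , λ ()
  quotient-∅ {suc n} (node ω p F) with quotient F (replicate n false) | quotient-∅ F
  ... | .(n , F , f) | f , refl , pf rewrite map-id p f pf = _ , refl , λ { zero → refl ; (suc i) → cong suc (pf i) }

  data SameQuotient {n} : QuotientResult n → QuotientResult n → Set o where
    sameQuotient : ∀ {m G f g} → (∀ i → f i ≡ g i) → SameQuotient (m , G , f) (m , G , g)

  sameQuotient-cong : ∀ {n m} {G G' : Forest Ω m} {f g : Fin n → Fin m} → G ≡ G' → (∀ i → f i ≡ g i) →
             SameQuotient (m , G , f) (m , G' , g)
  sameQuotient-cong refl e = sameQuotient e

  _∘ᵠ_ : ∀ {n} (r : QuotientResult n) → QuotientResult (proj₁ r) → QuotientResult n
  _∘ᵠ_ (m , G , f) (k , H , g) = (k , H , λ i → g (f i))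

  addDecoᵐ : ∀ {m} → Forest Ω m → Maybe (Fin m) → Ω → Forest Ω m
  addDecoᵐ G nothing α = G
  addDecoᵐ G (just j) α = addDeco G j α

  addDecoᵐ-map-suc : ∀ {m} ω (p : Maybe (Fin m)) (G : Forest Ω m) x α →
     addDecoᵐ (node ω p G) (Maybe.map suc x) α ≡ node ω p (addDecoᵐ G x α)
  addDecoᵐ-map-suc ω p G nothing α = refl
  addDecoᵐ-map-suc ω p G (just x) α = refl

  restrict-addDeco : ∀ {m} (G : Forest Ω m) j α Y →
     SameRestriction (restrict (addDeco G j α) Y) (size∣ G Y , addDecoᵐ (forest∣ G Y) (embed∣ G Y j) α , embed∣ G Y)
  restrict-addDeco (node ω' p' G) zero α (true ∷ Y) = sameRestriction-cong refl (λ { zero → refl ; (suc i) → refl })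
  restrict-addDeco (node ω' p' G) zero α (false ∷ Y) = sameRestriction-cong refl (λ { zero → refl ; (suc i) → refl })
  restrict-addDeco (node ω' p' G) (suc j) α (true ∷ Y) with restrict (addDeco G j α) Y | restrict-addDeco G j α Y
  ... | _ | sameRestriction pf = sameRestriction-cong (P.trans (cong (λ z → node ω' z _) (>>=-cong p' pf)) (P.sym (addDecoᵐ-map-suc ω' _ _ (embed∣ G Y j) α)))
                              (λ { zero → refl ; (suc i) → cong (Maybe.map suc) (pf i) })
  restrict-addDeco (node ω' p' G) (suc j) α (false ∷ Y) with restrict (addDeco G j α) Y | restrict-addDeco G j α Y
  ... | _ | sameRestriction pf = sameRestriction-cong refl (λ { zero → refl ; (suc i) → pf i })

  data RestrictsQuotient {n m w} (f : Fin n → Fin m) (r : Fin n → Maybe (Fin w)) : RestrictResult m → QuotientResult w → Set o where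
    restrictsQuotient : ∀ {k G ρ g} → (∀ v → ρ (f v) ≡ Maybe.map g (r v)) → RestrictsQuotient f r (k , G , ρ) (k , G , g)

  restrictsQuotient-cong : ∀ {n m w k} {f : Fin n → Fin m} {r : Fin n → Maybe (Fin w)} {G G' : Forest Ω k} {ρ g} →
     G ≡ G' → (∀ v → ρ (f v) ≡ Maybe.map g (r v)) → RestrictsQuotient f r (k , G , ρ) (k , G' , g)
  restrictsQuotient-cong refl e = restrictsQuotient e

  restrictsQuotient-forest : ∀ {n m w} {f : Fin n → Fin m} {r : Fin n → Maybe (Fin w)} {a b} → RestrictsQuotient f r a b →
     _≡_ {A = Σ ℕ (Forest Ω)} (proj₁ a , proj₁ (proj₂ a)) (proj₁ b , proj₁ (proj₂ b))
  restrictsQuotient-forest (restrictsQuotient _) = refl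

  restrict-quotient : ∀ {n} (F : Forest Ω n) S (Y : Subset (size/ F S)) W → (∀ v → lookup W v ≡ lookup Y (block/ F S v)) →
       RestrictsQuotient (block/ F S) (embed∣ F W) (restrict (forest/ F S) Y) (quotient (forest∣ F W) (shrink∣ F W S))
  restrict-quotient ∅ [] [] [] W-lookup = restrictsQuotient (λ ())
  restrict-quotient (node ω (just q) F) (true ∷ S) Y (true ∷ W) W-lookup
    with restrict (forest/ F S) Y | quotient (forest∣ F W) (shrink∣ F W S) | restrict (addDeco (forest/ F S) (block/ F S q) ω) Y
       | restrict-addDeco (forest/ F S) (block/ F S q) ω Y | restrict-quotient F S Y W (λ v → W-lookup (suc v))
  ... | k , G , ρ | _ | _ | sameRestriction addDeco-eq | restrictsQuotient ρ∘block with embed∣ F W q in embed-q | ρ∘block q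
  ...   | just q' | e rewrite e =
          restrictsQuotient-cong refl (λ { zero → P.trans (addDeco-eq (block/ F S q)) e
                           ; (suc v) → P.trans (addDeco-eq (block/ F S v)) (P.trans (ρ∘block v) (P.sym (map-map suc _ (embed∣ F W v)))) })
  ...   | nothing | e with embed∣-inside F W q (P.trans (W-lookup (suc q)) (P.sym (W-lookup zero)))
  ...     | j , ej with P.trans (P.sym ej) embed-q
  ...       | ()
  restrict-quotient (node ω (just q) F) (true ∷ S) Y (false ∷ W) W-lookup
    with restrict (forest/ F S) Y | quotient (forest∣ F W) (shrink∣ F W S) | restrict (addDeco (forest/ F S) (block/ F S q) ω) Y
       | restrict-addDeco (forest/ F S) (block/ F S q) ω Y | restrict-quotient F S Y W (λ v → W-lookup (suc v))
  ... | k , G , ρ | _ | _ | sameRestriction addDeco-eq | restrictsQuotient ρ∘block with embed∣-outside F W q (P.trans (W-lookup (suc q)) (P.sym (W-lookup zero)))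
  ...   | embed-q with ρ∘block q
  ...     | e rewrite embed-q | e =
          restrictsQuotient-cong refl (λ { zero → P.trans (addDeco-eq (block/ F S q)) (P.trans (ρ∘block q) (cong (Maybe.map _) embed-q))
                           ; (suc v) → P.trans (addDeco-eq (block/ F S v)) (ρ∘block v) })
  restrict-quotient (node ω p F) (false ∷ S) (true ∷ Y) (true ∷ W) W-lookup
    with restrict (forest/ F S) Y | quotient (forest∣ F W) (shrink∣ F W S) | restrict-quotient F S Y W (λ v → W-lookup (suc v))
  ... | k , G , ρ | _ | restrictsQuotient ρ∘block =
    restrictsQuotient-cong (cong (λ z → node ω z G) (map->>=-natural (block/ F S) ρ _ (embed∣ F W) p ρ∘block))
             (λ { zero → refl
                ; (suc v) → P.trans (cong (Maybe.map suc) (ρ∘block v)) (P.trans (map-map _ suc (embed∣ F W v)) (P.sym (map-map suc _ (embed∣ F W v)))) })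
  restrict-quotient (node ω p F) (false ∷ S) (false ∷ Y) (false ∷ W) W-lookup
    with restrict (forest/ F S) Y | quotient (forest∣ F W) (shrink∣ F W S) | restrict-quotient F S Y W (λ v → W-lookup (suc v))
  ... | k , G , ρ | _ | restrictsQuotient ρ∘block = restrictsQuotient-cong refl (λ { zero → refl ; (suc v) → ρ∘block v })
  restrict-quotient (node ω p F) (false ∷ S) (true ∷ Y) (false ∷ W) W-lookup with W-lookup zero
  ... | ()
  restrict-quotient (node ω p F) (false ∷ S) (false ∷ Y) (true ∷ W) W-lookup with W-lookup zero
  ... | ()
  restrict-quotient (node ω nothing F) (true ∷ S) (true ∷ Y) (true ∷ W) W-lookup
    with restrict (forest/ F S) Y | quotient (forest∣ F W) (shrink∣ F W S) | restrict-quotient F S Y W (λ v → W-lookup (suc v))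
  ... | k , G , ρ | _ | restrictsQuotient ρ∘block =
    restrictsQuotient-cong refl
             (λ { zero → refl
                ; (suc v) → P.trans (cong (Maybe.map suc) (ρ∘block v)) (P.trans (map-map _ suc (embed∣ F W v)) (P.sym (map-map suc _ (embed∣ F W v)))) })
  restrict-quotient (node ω nothing F) (true ∷ S) (false ∷ Y) (false ∷ W) W-lookup
    with restrict (forest/ F S) Y | quotient (forest∣ F W) (shrink∣ F W S) | restrict-quotient F S Y W (λ v → W-lookup (suc v))
  ... | k , G , ρ | _ | restrictsQuotient ρ∘block = restrictsQuotient-cong refl (λ { zero → refl ; (suc v) → ρ∘block v })
  restrict-quotient (node ω nothing F) (true ∷ S) (true ∷ Y) (false ∷ W) W-lookup with W-lookup zero
  ... | ()
  restrict-quotient (node ω nothing F) (true ∷ S) (false ∷ Y) (true ∷ W) W-lookup with W-lookup zero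
  ... | ()

  restrict-quotient-forest : ∀ {n} (F : Forest Ω n) S (Y : Subset (size/ F S)) W → (∀ v → lookup W v ≡ lookup Y (block/ F S v)) →
    (forest/ F S ∣ Y) ≡ (size/ (forest∣ F W) (shrink∣ F W S) , forest/ (forest∣ F W) (shrink∣ F W S))
  restrict-quotient-forest F S Y W W-lookup = restrictsQuotient-forest (restrict-quotient F S Y W W-lookup)

  saturatedAt : ∀ {n} → Bool → Maybe (Fin n) → Bool → Subset n → Bool
  saturatedAt true (just q) w W = w ≡ᵇ lookup W q
  saturatedAt true nothing w W = true
  saturatedAt false p w W = true

  saturatedᵇ : ∀ {n} → Forest Ω n → Subset n → Subset n → Bool
  saturatedᵇ ∅ [] [] = true
  saturatedᵇ (node ω p F) (s ∷ S) (w ∷ W) = saturatedAt s p w W ∧ saturatedᵇ F S W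

  -- Extends the values of X on the heads to their blocks; saturatedᵇ F S W says
  -- that W is a union of blocks.
  saturate : ∀ {n} → Forest Ω n → Subset n → Subset n → Subset n
  saturate ∅ [] [] = []
  saturate (node ω p F) (false ∷ S) (x ∷ X) = x ∷ saturate F S X
  saturate (node ω (just q) F) (true ∷ S) (x ∷ X) = lookup (saturate F S X) q ∷ saturate F S X
  saturate (node ω nothing F) (true ∷ S) (x ∷ X) = x ∷ saturate F S X

  shrink/-saturate : ∀ {n} (F : Forest Ω n) S X → shrink/ F S (saturate F S X) ≡ shrink/ F S X
  shrink/-saturate ∅ [] [] = refl
  shrink/-saturate (node ω p F) (false ∷ S) (x ∷ X) = cong (x ∷_) (shrink/-saturate F S X)
  shrink/-saturate (node ω (just q) F) (true ∷ S) (x ∷ X) = shrink/-saturate F S X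
  shrink/-saturate (node ω nothing F) (true ∷ S) (x ∷ X) = cong (x ∷_) (shrink/-saturate F S X)

  saturated-lookup : ∀ {n} (F : Forest Ω n) S W → saturatedᵇ F S W ≡ true → ∀ v → lookup W v ≡ lookup (shrink/ F S W) (block/ F S v)
  saturated-lookup (node ω p F) (false ∷ S) (w ∷ W) e zero = refl
  saturated-lookup (node ω p F) (false ∷ S) (w ∷ W) e (suc v) = saturated-lookup F S W e v
  saturated-lookup (node ω nothing F) (true ∷ S) (w ∷ W) e zero = refl
  saturated-lookup (node ω nothing F) (true ∷ S) (w ∷ W) e (suc v) = saturated-lookup F S W e v
  saturated-lookup (node ω (just q) F) (true ∷ S) (w ∷ W) e zero =
    P.trans (P.sym (≡ᵇ⇒≡ w (lookup W q) (∧-projˡ (w ≡ᵇ lookup W q) (saturatedᵇ F S W) e)))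
            (saturated-lookup F S W (∧-projʳ (w ≡ᵇ lookup W q) (saturatedᵇ F S W) e) q)
  saturated-lookup (node ω (just q) F) (true ∷ S) (w ∷ W) e (suc v) = saturated-lookup F S W (∧-projʳ (w ≡ᵇ lookup W q) (saturatedᵇ F S W) e) v

  saturatedᵇ-∁ : ∀ {n} (F : Forest Ω n) S W → saturatedᵇ F S (∁ W) ≡ saturatedᵇ F S W
  saturatedᵇ-∁ ∅ [] [] = refl
  saturatedᵇ-∁ (node ω p F) (false ∷ S) (w ∷ W) = cong (true ∧_) (saturatedᵇ-∁ F S W)
  saturatedᵇ-∁ (node ω nothing F) (true ∷ S) (w ∷ W) = cong (true ∧_) (saturatedᵇ-∁ F S W)
  saturatedᵇ-∁ (node ω (just q) F) (true ∷ S) (w ∷ W) =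
    cong₂ _∧_ (P.trans (cong (_≡ᵇ_ (not w)) (lookup-∁ W q)) (≡ᵇ-not w (lookup W q))) (saturatedᵇ-∁ F S W)

  shrink/-∁ : ∀ {n} (F : Forest Ω n) S W → shrink/ F S (∁ W) ≡ ∁ (shrink/ F S W)
  shrink/-∁ ∅ [] [] = refl
  shrink/-∁ (node ω p F) (false ∷ S) (w ∷ W) = cong (not w ∷_) (shrink/-∁ F S W)
  shrink/-∁ (node ω (just q) F) (true ∷ S) (w ∷ W) = shrink/-∁ F S W
  shrink/-∁ (node ω nothing F) (true ∷ S) (w ∷ W) = cong (not w ∷_) (shrink/-∁ F S W)

  saturatedᵇ-blocks : ∀ {n} (F : Forest Ω n) S U → S ⊆ᵇ U ≡ true → ∀ (Pr : Fin (size/ F U) → Bool) →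
            saturatedᵇ F S (tabulate (λ v → Pr (block/ F U v))) ≡ true
  saturatedᵇ-blocks ∅ [] [] h Pr = refl
  saturatedᵇ-blocks (node ω p F) (false ∷ S) (false ∷ U) h Pr = saturatedᵇ-blocks F S U h (λ j → Pr (suc j))
  saturatedᵇ-blocks (node ω nothing F) (false ∷ S) (true ∷ U) h Pr = saturatedᵇ-blocks F S U h (λ j → Pr (suc j))
  saturatedᵇ-blocks (node ω (just q) F) (false ∷ S) (true ∷ U) h Pr = saturatedᵇ-blocks F S U h Pr
  saturatedᵇ-blocks (node ω nothing F) (true ∷ S) (true ∷ U) h Pr = saturatedᵇ-blocks F S U h (λ j → Pr (suc j))
  saturatedᵇ-blocks (node ω (just q) F) (true ∷ S) (true ∷ U) h Pr =
    cong₂ _∧_ (P.trans (cong (_≡ᵇ_ (Pr (block/ F U q))) (lookup∘tabulate (λ v → Pr (block/ F U v)) q)) (≡ᵇ-refl (Pr (block/ F U q))))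
              (saturatedᵇ-blocks F S U h Pr)

  downClosedᵇ-addDeco : ∀ {m} (G : Forest Ω m) j α Y → downClosedᵇ (addDeco G j α) Y ≡ downClosedᵇ G Y
  downClosedᵇ-addDeco (node ω p G) zero α (y ∷ Y) = refl
  downClosedᵇ-addDeco (node ω p G) (suc j) α (y ∷ Y) = cong ((not y ∨ ∈ᵐ p Y) ∧_) (downClosedᵇ-addDeco G j α Y)

  downClosedᵇ-quotient : ∀ {n} (F : Forest Ω n) S W → coverᵇ F S ≡ true → saturatedᵇ F S W ≡ true → downClosedᵇ (forest/ F S) (shrink/ F S W) ≡ downClosedᵇ F W
  downClosedᵇ-quotient ∅ [] [] c s = refl
  downClosedᵇ-quotient (node ω nothing F) (false ∷ S) (w ∷ W) c s = cong ((not w ∨ true) ∧_) (downClosedᵇ-quotient F S W c s)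
  downClosedᵇ-quotient (node ω (just q) F) (false ∷ S) (w ∷ W) c s =
    cong₂ _∧_ (cong (not w ∨_) (P.sym (saturated-lookup F S W s q))) (downClosedᵇ-quotient F S W c s)
  downClosedᵇ-quotient (node ω nothing F) (true ∷ S) (w ∷ W) () s
  downClosedᵇ-quotient (node ω (just q) F) (true ∷ S) (w ∷ W) c s =
    P.trans (downClosedᵇ-addDeco (forest/ F S) (block/ F S q) ω (shrink/ F S W))
    (P.trans (downClosedᵇ-quotient F S W c (∧-projʳ (w ≡ᵇ lookup W q) (saturatedᵇ F S W) s))
     (cong (_∧ downClosedᵇ F W) (P.sym (P.trans (cong (not w ∨_) (≡ᵇ⇒≡ w (lookup W q) (∧-projˡ (w ≡ᵇ lookup W q) (saturatedᵇ F S W) s))) (not-∨-self w)))))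

  ⊆ᵇheads≡disjointᵇ : ∀ {n} (F : Forest Ω n) S X → coverᵇ F S ≡ true → X ⊆ᵇ heads F S ≡ disjointᵇ S X
  ⊆ᵇheads≡disjointᵇ ∅ [] [] c = refl
  ⊆ᵇheads≡disjointᵇ (node ω p F) (false ∷ S) (true ∷ X) c = ⊆ᵇheads≡disjointᵇ F S X c
  ⊆ᵇheads≡disjointᵇ (node ω p F) (false ∷ S) (false ∷ X) c = ⊆ᵇheads≡disjointᵇ F S X c
  ⊆ᵇheads≡disjointᵇ (node ω (just q) F) (true ∷ S) (true ∷ X) c = refl
  ⊆ᵇheads≡disjointᵇ (node ω (just q) F) (true ∷ S) (false ∷ X) c = ⊆ᵇheads≡disjointᵇ F S X c
  ⊆ᵇheads≡disjointᵇ (node ω nothing F) (true ∷ S) X ()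

  coverᵇ-quotient : ∀ {n} (F : Forest Ω n) S X → coverᵇ F S ≡ true → X ⊆ᵇ heads F S ≡ true → coverᵇ (forest/ F S) (shrink/ F S X) ≡ coverᵇ F X
  coverᵇ-quotient ∅ [] [] c h = refl
  coverᵇ-quotient (node ω p F) (false ∷ S) (true ∷ X) c h = cong₂ _∧_ (is-just-map (block/ F S) p) (coverᵇ-quotient F S X c h)
  coverᵇ-quotient (node ω p F) (false ∷ S) (false ∷ X) c h = coverᵇ-quotient F S X c h
  coverᵇ-quotient (node ω (just q) F) (true ∷ S) (true ∷ X) c ()
  coverᵇ-quotient (node ω (just q) F) (true ∷ S) (false ∷ X) c h =
    P.trans (coverᵇ-addDeco (forest/ F S) (block/ F S q) ω (shrink/ F S X)) (coverᵇ-quotient F S X c h)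
  coverᵇ-quotient (node ω nothing F) (true ∷ S) X () h

  coverᵇ-split : ∀ {n} (F : Forest Ω n) S W →
    coverᵇ (forest∣ F W) (shrink∣ F W S) ∧ coverᵇ (forest∣ F (∁ W)) (shrink∣ F (∁ W) S) ≡ coverᵇ F S ∧ saturatedᵇ F S W
  coverᵇ-split ∅ [] [] = refl
  coverᵇ-split (node ω p F) (s ∷ S) (true ∷ W) =
    P.trans (∧-assoc (not s ∨ is-just (p >>= embed∣ F W)) _ _)
    (P.trans (cong₂ _∧_ (edge-condition s p) (coverᵇ-split F S W))
     (∧-interchange (not s ∨ is-just p) (saturatedAt s p true W) (coverᵇ F S) (saturatedᵇ F S W)))
    where
      edge-condition : ∀ s p → (not s ∨ is-just (p >>= embed∣ F W)) ≡ (not s ∨ is-just p) ∧ saturatedAt s p true W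
      edge-condition false p = refl
      edge-condition true nothing = refl
      edge-condition true (just q) = is-just-embed∣ F W q
  coverᵇ-split (node ω p F) (s ∷ S) (false ∷ W) =
    P.trans (∧-swap (coverᵇ (forest∣ F W) (shrink∣ F W S)) (not s ∨ is-just (p >>= embed∣ F (∁ W))) _)
    (P.trans (cong₂ _∧_ (edge-condition s p) (coverᵇ-split F S W))
     (∧-interchange (not s ∨ is-just p) (saturatedAt s p false W) (coverᵇ F S) (saturatedᵇ F S W)))
    where
      edge-condition : ∀ s p → (not s ∨ is-just (p >>= embed∣ F (∁ W))) ≡ (not s ∨ is-just p) ∧ saturatedAt s p false W
      edge-condition false p = refl
      edge-condition true nothing = refl
      edge-condition true (just q) = P.trans (is-just-embed∣ F (∁ W) q) (lookup-∁ W q)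

  coverᵇ-block : ∀ {n} (F : Forest Ω n) S U → coverᵇ F U ≡ true → S ⊆ᵇ U ≡ true → ∀ k →
           coverᵇ (forest∣ F (blockOf (block/ F U) k)) (shrink∣ F (blockOf (block/ F U) k) S) ≡ true
  coverᵇ-block F S U c h k =
    ∧-projˡ _ (coverᵇ (forest∣ F (∁ (blockOf (block/ F U) k))) (shrink∣ F (∁ (blockOf (block/ F U) k)) S))
      (P.trans (coverᵇ-split F S (blockOf (block/ F U) k))
               (cong₂ _∧_ (coverᵇ-⊆ᵇ F S U h c) (saturatedᵇ-blocks F S U h (λ j → does (j ≟ k)))))

  coverᵇ-some-block : ∀ {n} (F : Forest Ω n) S U → S ⊆ᵇ U ≡ false →
    Σ (Fin (size/ F U)) (λ k → coverᵇ (forest∣ F (blockOf (block/ F U) k)) (shrink∣ F (blockOf (block/ F U) k) S) ≡ false)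
  coverᵇ-some-block F S U S⊈U with ⊈ᵇ-witness S U S⊈U
  ... | v , v∈S , v∉U with coverᵇ (forest∣ F (blockOf (block/ F U) (block/ F U v))) (shrink∣ F (blockOf (block/ F U) (block/ F U v)) S) in ec
  ...   | false = block/ F U v , ec
  ...   | true = ⊥-elim parent-in-block
    where
      B = blockOf (block/ F U) (block/ F U v)
      v∈B : lookup B v ≡ true
      v∈B = P.trans (lookup-blockOf (block/ F U) _ v) (≟-refl (block/ F U v))
      -- the edge of S at v would have to stay inside the block of v, but U cuts it
      parent-in-block : ⊥
      parent-in-block with embed∣-inside F B v v∈B
      ... | x , ex with coverᵇ-parent (forest∣ F B) (shrink∣ F B S) x ec (P.trans (lookup-shrink∣ F B S v x ex) v∈S)
      ...   | has-parent rewrite parentOf-embed∣ F B v x ex with parentOf F v in parent≡u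
      ...     | just u = cut-edge-separates F U v u v∉U parent≡u
                  (does-≟⇒≡ (P.trans (P.sym (lookup-blockOf (block/ F U) (block/ F U v) u)) (P.trans (P.sym (is-just-embed∣ F B u)) has-parent)))
  module Associative (⊕-assoc : ∀ x y z → (x ⊕ y) ⊕ z ≡ x ⊕ (y ⊕ z)) (⊕-comm : ∀ x y → x ⊕ y ≡ y ⊕ x) where

    addDeco-addDeco : ∀ {m} (G : Forest Ω m) j a b → addDeco (addDeco G j a) j b ≡ addDeco G j (a ⊕ b)
    addDeco-addDeco (node ω p G) zero a b = cong (λ z → node z p G) (⊕-assoc ω a b)
    addDeco-addDeco (node ω p G) (suc j) a b = cong (node ω p) (addDeco-addDeco G j a b)

    addDeco-comm : ∀ {m} (G : Forest Ω m) i j a b → addDeco (addDeco G i a) j b ≡ addDeco (addDeco G j b) i a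
    addDeco-comm (node ω p G) zero zero a b =
      cong (λ z → node z p G) (P.trans (⊕-assoc ω a b) (P.trans (cong (ω ⊕_) (⊕-comm a b)) (P.sym (⊕-assoc ω b a))))
    addDeco-comm (node ω p G) zero (suc j) a b = refl
    addDeco-comm (node ω p G) (suc i) zero a b = refl
    addDeco-comm (node ω p G) (suc i) (suc j) a b = cong (node ω p) (addDeco-comm G i j a b)

    quotient-addDeco : ∀ {m} (Q : Forest Ω m) j α T →
       SameQuotient (quotient (addDeco Q j α) T) (size/ Q T , addDeco (forest/ Q T) (block/ Q T j) α , block/ Q T)
    quotient-addDeco (node ω' p' Q) zero α (false ∷ T) = sameQuotient-cong refl (λ { zero → refl ; (suc i) → refl })
    quotient-addDeco (node ω' nothing Q) zero α (true ∷ T) = sameQuotient-cong refl (λ { zero → refl ; (suc i) → refl })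
    quotient-addDeco (node ω' (just q) Q) zero α (true ∷ T) =
      sameQuotient-cong (P.sym (addDeco-addDeco (forest/ Q T) (block/ Q T q) ω' α)) (λ { zero → refl ; (suc i) → refl })
    quotient-addDeco (node ω' p' Q) (suc j) α (false ∷ T) with quotient (addDeco Q j α) T | quotient-addDeco Q j α T
    ... | _ | sameQuotient pf = sameQuotient-cong (cong (λ z → node ω' z _) (map-cong pf p')) (λ { zero → refl ; (suc i) → cong suc (pf i) })
    quotient-addDeco (node ω' nothing Q) (suc j) α (true ∷ T) with quotient (addDeco Q j α) T | quotient-addDeco Q j α T
    ... | _ | sameQuotient pf = sameQuotient-cong refl (λ { zero → refl ; (suc i) → cong suc (pf i) })
    quotient-addDeco (node ω' (just q) Q) (suc j) α (true ∷ T) with quotient (addDeco Q j α) T | quotient-addDeco Q j α T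
    ... | _ | sameQuotient pf = sameQuotient-cong (P.trans (cong (λ z → addDeco (addDeco (forest/ Q T) (block/ Q T j) α) z ω') (pf q))
                                          (addDeco-comm (forest/ Q T) (block/ Q T j) (block/ Q T q) α ω'))
                                (λ { zero → pf q ; (suc i) → pf i })

    quotient-quotient : ∀ {n} (F : Forest Ω n) S X → SameQuotient (_∘ᵠ_ (quotient F S) (quotient (forest/ F S) (shrink/ F S X))) (quotient F (S ∪ X))
    quotient-quotient ∅ [] [] = sameQuotient (λ ())
    quotient-quotient (node ω (just q) F) (true ∷ S) (x ∷ X)
      with quotient (addDeco (forest/ F S) (block/ F S q) ω) (shrink/ F S X) | quotient (forest/ F S) (shrink/ F S X)
         | quotient F (S ∪ X) | quotient-addDeco (forest/ F S) (block/ F S q) ω (shrink/ F S X) | quotient-quotient F S X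
    ... | _ | k , P , g | _ | sameQuotient pa | sameQuotient pq =
      sameQuotient-cong (cong (λ z → addDeco P z ω) (pq q))
               (λ { zero → P.trans (pa (block/ F S q)) (pq q) ; (suc i) → P.trans (pa (block/ F S i)) (pq i) })
    quotient-quotient (node ω nothing F) (true ∷ S) (true ∷ X) with quotient (forest/ F S) (shrink/ F S X) | quotient F (S ∪ X) | quotient-quotient F S X
    ... | k , P , g | _ | sameQuotient pq = sameQuotient (λ { zero → refl ; (suc i) → cong suc (pq i) })
    quotient-quotient (node ω nothing F) (true ∷ S) (false ∷ X) with quotient (forest/ F S) (shrink/ F S X) | quotient F (S ∪ X) | quotient-quotient F S X
    ... | k , P , g | _ | sameQuotient pq = sameQuotient (λ { zero → refl ; (suc i) → cong suc (pq i) })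
    quotient-quotient (node ω p F) (false ∷ S) (false ∷ X) with quotient (forest/ F S) (shrink/ F S X) | quotient F (S ∪ X) | quotient-quotient F S X
    ... | k , P , g | _ | sameQuotient pq =
      sameQuotient-cong (cong (λ z → node ω z P) (map-∘-≗ (block/ F S) g _ p pq)) (λ { zero → refl ; (suc i) → cong suc (pq i) })
    quotient-quotient (node ω nothing F) (false ∷ S) (true ∷ X) with quotient (forest/ F S) (shrink/ F S X) | quotient F (S ∪ X) | quotient-quotient F S X
    ... | k , P , g | _ | sameQuotient pq = sameQuotient (λ { zero → refl ; (suc i) → cong suc (pq i) })
    quotient-quotient (node ω (just q) F) (false ∷ S) (true ∷ X) with quotient (forest/ F S) (shrink/ F S X) | quotient F (S ∪ X) | quotient-quotient F S X
    ... | k , P , g | _ | sameQuotient pq =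
      sameQuotient-cong (cong (λ z → addDeco P z ω) (pq q)) (λ { zero → pq q ; (suc i) → pq i })

module Sums {c ℓ} (R : CommutativeSemiring c ℓ) where
  open CommutativeSemiring R renaming (refl to ≈refl; sym to ≈sym; trans to ≈trans; zero to *-zero)
  private
    module +P = CSP +-commutativeSemigroup
    module *P = CSP *-commutativeSemigroup

  ≡⇒≈ : ∀ {x y} → x ≡ y → x ≈ y
  ≡⇒≈ refl = ≈refl

  when : Bool → Carrier → Carrier
  when true x = x
  when false x = 0#

  when¹ : Bool → Carrier → Carrier
  when¹ true x = x
  when¹ false x = 1#

  when-0 : ∀ b → when b 0# ≈ 0#
  when-0 true = ≈refl
  when-0 false = ≈refl

  when-true : ∀ {b} x → b ≡ true → when b x ≈ x
  when-true x refl = ≈refl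

  when-cong : ∀ b {x y} → x ≈ y → when b x ≈ when b y
  when-cong true e = e
  when-cong false e = ≈refl

  when-+ : ∀ b x y → when b (x + y) ≈ when b x + when b y
  when-+ true x y = ≈refl
  when-+ false x y = ≈sym (+-identityˡ 0#)

  ∑ : (n : ℕ) → (Subset n → Carrier) → Carrier
  ∑ zero h = h []
  ∑ (suc n) h = ∑ n (λ V → h (true ∷ V) + h (false ∷ V))

  ∑-cong : ∀ n {h g : Subset n → Carrier} → (∀ V → h V ≈ g V) → ∑ n h ≈ ∑ n g
  ∑-cong zero e = e []
  ∑-cong (suc n) e = ∑-cong n (λ V → +-cong (e (true ∷ V)) (e (false ∷ V)))

  ∑-+ : ∀ n (h g : Subset n → Carrier) → ∑ n (λ V → h V + g V) ≈ ∑ n h + ∑ n g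
  ∑-+ zero h g = ≈refl
  ∑-+ (suc n) h g = ≈trans (∑-cong n (λ V → +P.interchange _ _ _ _))
                           (∑-+ n (λ V → h (true ∷ V) + h (false ∷ V)) (λ V → g (true ∷ V) + g (false ∷ V)))

  ∑-distribˡ : ∀ n x (h : Subset n → Carrier) → x * ∑ n h ≈ ∑ n (λ V → x * h V)
  ∑-distribˡ zero x h = ≈refl
  ∑-distribˡ (suc n) x h = ≈trans (∑-distribˡ n x _) (∑-cong n (λ V → distribˡ x _ _))

  ∑-distribʳ : ∀ n x (h : Subset n → Carrier) → ∑ n h * x ≈ ∑ n (λ V → h V * x)
  ∑-distribʳ n x h = ≈trans (*-comm _ x) (≈trans (∑-distribˡ n x h) (∑-cong n (λ V → *-comm x _)))

  ∑-0 : ∀ n → ∑ n (λ _ → 0#) ≈ 0#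
  ∑-0 zero = ≈refl
  ∑-0 (suc n) = ≈trans (∑-cong n (λ _ → +-identityˡ 0#)) (∑-0 n)

  when-∑ : ∀ b n (h : Subset n → Carrier) → when b (∑ n h) ≈ ∑ n (λ X → when b (h X))
  when-∑ true n h = ≈refl
  when-∑ false n h = ≈sym (∑-0 n)

  ∑-comm : ∀ n m (h : Subset n → Subset m → Carrier) →
            ∑ n (λ V → ∑ m (λ W → h V W)) ≈ ∑ m (λ W → ∑ n (λ V → h V W))
  ∑-comm zero m h = ≈refl
  ∑-comm (suc n) m h = ≈trans (∑-cong n (λ V → ≈sym (∑-+ m _ _)))
                             (∑-comm n m (λ V W → h (true ∷ V) W + h (false ∷ V) W))

  ∑-supported-on-∅ : ∀ n (h : Subset n → Carrier) → (∀ V → isEmptyᵇ V ≡ false → h V ≈ 0#) →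
            ∑ n h ≈ h (replicate n false)
  ∑-supported-on-∅ zero h z = ≈refl
  ∑-supported-on-∅ (suc n) h z =
    ≈trans (∑-supported-on-∅ n _ (λ V e → ≈trans (+-cong (z (true ∷ V) refl) (z (false ∷ V) e)) (+-identityˡ 0#)))
          (≈trans (+-congʳ (z (true ∷ replicate n false) refl)) (+-identityˡ _))

  ∑-∁ : ∀ n (h : Subset n → Carrier) → ∑ n h ≈ ∑ n (λ V → h (∁ V))
  ∑-∁ zero h = ≈refl
  ∑-∁ (suc n) h = ≈trans (∑-cong n (λ V → +-comm _ _)) (∑-∁ n _)

  ∑-nested-⊆ᵇ : ∀ n (g : Subset n → Subset n → Carrier) →
    ∑ n (λ V → ∑ n (λ X → when (X ⊆ᵇ V) (g X V))) ≈ ∑ n (λ A → ∑ n (λ B → when (disjointᵇ A B) (g A (A ∪ B))))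
  ∑-nested-⊆ᵇ zero g = ≈refl
  ∑-nested-⊆ᵇ (suc n) g =
    ≈trans (∑-cong n (λ V → ≈trans (≈sym (∑-+ n _ _)) (∑-cong n (λ X → regroup-⊆ᵇ (X ⊆ᵇ V) _ _ _))))
    (≈trans (∑-nested-⊆ᵇ n (λ X V → g (true ∷ X) (true ∷ V) + (g (false ∷ X) (true ∷ V) + g (false ∷ X) (false ∷ V))))
     (∑-cong n (λ A → ≈trans (∑-cong n (λ B → ≈sym (regroup-disjointᵇ (disjointᵇ A B) _ _ _))) (∑-+ n _ _))))
    where
      regroup-⊆ᵇ : ∀ k a b d → (when k a + when k b) + (0# + when k d) ≈ when k (a + (b + d))
      regroup-⊆ᵇ true a b d = ≈trans (+-congˡ (+-identityˡ d)) (+-assoc a b d)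
      regroup-⊆ᵇ false a b d = ≈trans (+-cong (+-identityˡ 0#) (+-identityˡ 0#)) (+-identityˡ 0#)
      regroup-disjointᵇ : ∀ k a b d → (0# + when k a) + (when k b + when k d) ≈ when k (a + (b + d))
      regroup-disjointᵇ true a b d = +-congʳ (+-identityˡ a)
      regroup-disjointᵇ false a b d = ≈trans (+-cong (+-identityˡ 0#) (+-identityˡ 0#)) (+-identityˡ 0#)

  ∏ : (n : ℕ) → (Fin n → Carrier) → Carrier
  ∏ zero φ = 1#
  ∏ (suc n) φ = φ zero * ∏ n (λ i → φ (suc i))

  ∏-cong : ∀ n {φ ψ : Fin n → Carrier} → (∀ i → φ i ≈ ψ i) → ∏ n φ ≈ ∏ n ψ
  ∏-cong zero e = ≈refl
  ∏-cong (suc n) e = *-cong (e zero) (∏-cong n (λ i → e (suc i)))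

  ∏-zero : ∀ n (φ : Fin n → Carrier) j → φ j ≈ 0# → ∏ n φ ≈ 0#
  ∏-zero (suc n) φ zero e = ≈trans (*-congʳ e) (zeroˡ _)
  ∏-zero (suc n) φ (suc j) e = ≈trans (*-congˡ (∏-zero n _ j e)) (zeroʳ _)

  ∏-one : ∀ n (φ : Fin n → Carrier) → (∀ j → φ j ≈ 1#) → ∏ n φ ≈ 1#
  ∏-one zero φ e = ≈refl
  ∏-one (suc n) φ e = ≈trans (*-cong (e zero) (∏-one n _ (λ j → e (suc j)))) (*-identityˡ 1#)

  ∏-* : ∀ m (φ ψ : Fin m → Carrier) → ∏ m (λ j → φ j * ψ j) ≈ ∏ m φ * ∏ m ψ
  ∏-* zero φ ψ = ≈sym (*-identityˡ 1#)
  ∏-* (suc m) φ ψ = ≈trans (*-congˡ (∏-* m _ _)) (*P.interchange _ _ _ _)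

  ∏-comm : ∀ m l (φ : Fin m → Fin l → Carrier) → ∏ m (λ k → ∏ l (λ j → φ k j)) ≈ ∏ l (λ j → ∏ m (λ k → φ k j))
  ∏-comm zero l φ = ≈sym (∏-one l _ (λ _ → ≈refl))
  ∏-comm (suc m) l φ = ≈trans (*-congˡ (∏-comm m l (λ k j → φ (suc k) j))) (≈sym (∏-* l _ _))

  ∏-when¹-≟ : ∀ m (a : Fin m) x → ∏ m (λ k → when¹ (does (a ≟ k)) x) ≈ x
  ∏-when¹-≟ (suc m) zero x = ≈trans (*-congˡ (∏-one m _ (λ _ → ≈refl))) (*-identityʳ x)
  ∏-when¹-≟ (suc m) (suc a) x = ≈trans (*-identityˡ _) (∏-when¹-≟ m a x)

  ∏-split : ∀ m (Y : Subset m) (φ : Fin m → Carrier) →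
    ∏ m φ ≈ ∏ m (λ j → when¹ (lookup Y j) (φ j)) * ∏ m (λ j → when¹ (lookup (∁ Y) j) (φ j))
  ∏-split zero [] φ = ≈sym (*-identityˡ 1#)
  ∏-split (suc m) (true ∷ Y) φ =
    ≈trans (*-congˡ (∏-split m Y (λ j → φ (suc j))))
    (≈trans (≈sym (*-assoc _ _ _)) (*-congˡ (≈sym (*-identityˡ _))))
  ∏-split (suc m) (false ∷ Y) φ =
    ≈trans (*-congˡ (∏-split m Y (λ j → φ (suc j))))
    (≈trans (*P.x∙yz≈y∙xz _ _ _) (*-cong (≈sym (*-identityˡ _)) ≈refl))

  maybe¹ : ∀ {m} → (Fin m → Carrier) → Maybe (Fin m) → Carrier
  maybe¹ φ nothing = 1#
  maybe¹ φ (just j) = φ j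

  maybe¹-suc : ∀ {m} (φ : Fin (suc m) → Carrier) x → maybe¹ φ (Maybe.map suc x) ≡ maybe¹ (λ i → φ (suc i)) x
  maybe¹-suc φ nothing = refl
  maybe¹-suc φ (just x) = refl

  ∑⊆-*-∑⊆∁ : ∀ n (W : Subset n) (f g : Subset n → Carrier) →
    ∑ n (λ A → when (A ⊆ᵇ W) (f A)) * ∑ n (λ B → when (B ⊆ᵇ ∁ W) (g B)) ≈ ∑ n (λ S → f (W ∩ S) * g (∁ W ∩ S))
  ∑⊆-*-∑⊆∁ zero [] f g = ≈refl
  ∑⊆-*-∑⊆∁ (suc n) (true ∷ W) f g =
    ≈trans (*-cong (∑-cong n (λ A → ≈sym (when-+ (A ⊆ᵇ W) _ _))) (∑-cong n (λ B → +-identityˡ _)))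
    (≈trans (∑⊆-*-∑⊆∁ n W (λ A → f (true ∷ A) + f (false ∷ A)) (λ B → g (false ∷ B)))
     (∑-cong n (λ S → distribʳ _ _ _)))
  ∑⊆-*-∑⊆∁ (suc n) (false ∷ W) f g =
    ≈trans (*-cong (∑-cong n (λ A → +-identityˡ _)) (∑-cong n (λ B → ≈sym (when-+ (B ⊆ᵇ ∁ W) _ _))))
    (≈trans (∑⊆-*-∑⊆∁ n W (λ A → f (false ∷ A)) (λ B → g (true ∷ B) + g (false ∷ B)))
     (∑-cong n (λ S → distribˡ _ _ _)))

  ∑⊆-*-∑⊆-disjoint : ∀ n (W C : Subset n) (f g : Subset n → Carrier) → disjointᵇ W C ≡ true →
    ∑ n (λ A → when (A ⊆ᵇ W) (f A)) * ∑ n (λ B → when (B ⊆ᵇ C) (g B))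
      ≈ ∑ n (λ S → when (S ⊆ᵇ (W ∪ C)) (f (W ∩ S) * g (C ∩ S)))
  ∑⊆-*-∑⊆-disjoint zero [] [] f g d = ≈refl
  ∑⊆-*-∑⊆-disjoint (suc n) (true ∷ W) (false ∷ C) f g d =
    ≈trans (*-cong (∑-cong n (λ A → ≈sym (when-+ (A ⊆ᵇ W) _ _))) (∑-cong n (λ B → +-identityˡ _)))
    (≈trans (∑⊆-*-∑⊆-disjoint n W C (λ A → f (true ∷ A) + f (false ∷ A)) (λ B → g (false ∷ B)) d)
     (∑-cong n (λ S → ≈trans (when-cong (S ⊆ᵇ (W ∪ C)) (distribʳ _ _ _)) (when-+ (S ⊆ᵇ (W ∪ C)) _ _))))
  ∑⊆-*-∑⊆-disjoint (suc n) (false ∷ W) (true ∷ C) f g d =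
    ≈trans (*-cong (∑-cong n (λ A → +-identityˡ _)) (∑-cong n (λ B → ≈sym (when-+ (B ⊆ᵇ C) _ _))))
    (≈trans (∑⊆-*-∑⊆-disjoint n W C (λ A → f (false ∷ A)) (λ B → g (true ∷ B) + g (false ∷ B)) d)
     (∑-cong n (λ S → ≈trans (when-cong (S ⊆ᵇ (W ∪ C)) (distribˡ _ _ _)) (when-+ (S ⊆ᵇ (W ∪ C)) _ _))))
  ∑⊆-*-∑⊆-disjoint (suc n) (false ∷ W) (false ∷ C) f g d =
    ≈trans (*-cong (∑-cong n (λ A → +-identityˡ _)) (∑-cong n (λ B → +-identityˡ _)))
    (≈trans (∑⊆-*-∑⊆-disjoint n W C (λ A → f (false ∷ A)) (λ B → g (false ∷ B)) d)
     (∑-cong n (λ S → ≈sym (+-identityˡ _))))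
  ∑⊆-*-∑⊆-disjoint (suc n) (true ∷ W) (true ∷ C) f g ()

  ∏∑⊆-disjoint : ∀ n m (B : Fin m → Subset n) (ψ : Fin m → Subset n → Carrier) →
    (∀ v k k' → lookup (B k) v ≡ true → lookup (B k') v ≡ true → k ≡ k') →
    ∏ m (λ k → ∑ n (λ Z → when (Z ⊆ᵇ B k) (ψ k Z))) ≈ ∑ n (λ S → when (S ⊆ᵇ ⋃ m B) (∏ m (λ k → ψ k (B k ∩ S))))
  ∏∑⊆-disjoint n zero B ψ dj = ≈sym (≈trans (∑-supported-on-∅ n _ (λ S e → ≡⇒≈ (cong (λ b → when b 1#) (⊆ᵇ∅-nonEmpty S e))))
                                   (≡⇒≈ (cong (λ b → when b 1#) (∅⊆ᵇ∅ n))))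
  ∏∑⊆-disjoint n (suc m) B ψ dj =
    ≈trans (*-congˡ (∏∑⊆-disjoint n m (λ k → B (suc k)) (λ k → ψ (suc k)) (λ v k k' a b → FinP.suc-injective (dj v (suc k) (suc k') a b))))
    (≈trans (∑⊆-*-∑⊆-disjoint n (B zero) C _ _ B₀#C)
     (∑-cong n (λ S → when-cong (S ⊆ᵇ (B zero ∪ C))
       (*-congˡ (∏-cong m (λ k → ≡⇒≈ (cong (ψ (suc k)) (∩-absorb (B (suc k)) C S (⊆ᵇ-⋃ m (λ k → B (suc k)) k)))))))))
    where
      C = ⋃ m (λ k → B (suc k))
      B₀#C : disjointᵇ (B zero) C ≡ true
      B₀#C = disjointᵇ-lookup (B zero) C outside-C
        where
          outside-C : ∀ v → lookup (B zero) v ≡ true → lookup C v ≡ false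
          outside-C v e with lookup C v in ec
          ... | false = refl
          ... | true with ∈-⋃⁻ m (λ k → B (suc k)) v ec
          ...   | k , ek with dj v zero (suc k) e ek
          ...     | ()

module Moulds {c ℓ} (R : CommutativeRing c ℓ) {o} {Ω : Set o} (_⊕_ : Ω → Ω → Ω)
  (⊕-assoc : ∀ x y z → (x ⊕ y) ⊕ z ≡ x ⊕ (y ⊕ z)) (⊕-comm : ∀ x y → x ⊕ y ≡ y ⊕ x) where
  open CommutativeRing R renaming (refl to ≈refl; sym to ≈sym; trans to ≈trans; zero to *-zero)
  open MouldOps R _⊕_
  open Quotient {Ω = Ω} _⊕_
  open QuotientProperties _⊕_
  open Associative ⊕-assoc ⊕-comm
  open Sums commutativeSemiring
  open import Relation.Binary.Reasoning.Setoid setoid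
  module *P = CSP *-commutativeSemigroup

  sumL-filterᵇ : ∀ {A : Set} (p : A → Bool) (g : A → Carrier) (xs : List A) →
     sumL (List.map g (filterᵇ p xs)) ≈ sumL (List.map (λ x → when (p x) (g x)) xs)
  sumL-filterᵇ p g [] = ≈refl
  sumL-filterᵇ p g (x ∷ xs) with p x
  ... | true = +-congˡ (sumL-filterᵇ p g xs)
  ... | false = ≈trans (sumL-filterᵇ p g xs) (≈sym (+-identityˡ _))

  sumL-allSubsets : ∀ n (h : Subset n → Carrier) → sumL (List.map h (allSubsets n)) ≈ ∑ n h
  sumL-allSubsets zero h = +-identityʳ _
  sumL-allSubsets (suc n) h = ≈trans (expand (allSubsets n)) (sumL-allSubsets n _)
    where
      expand : ∀ xs → sumL (List.map h (concatMap (λ V → (true ∷ V) ∷ (false ∷ V) ∷ []) xs))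
                    ≈ sumL (List.map (λ V → h (true ∷ V) + h (false ∷ V)) xs)
      expand [] = ≈refl
      expand (V ∷ xs) = ≈trans (+-congˡ (+-congˡ (expand xs))) (≈sym (+-assoc _ _ _))

  prodFin≡∏ : ∀ n (φ : Fin n → Carrier) → prodFin n φ ≡ ∏ n φ
  prodFin≡∏ n φ = prodFin-tabulate n (λ i → i)
    where
      prodFin-tabulate : ∀ k (g : Fin k → Fin n) → foldr (λ j acc → φ j * acc) 1# (List.tabulate g) ≡ ∏ k (λ i → φ (g i))
      prodFin-tabulate zero g = refl
      prodFin-tabulate (suc k) g = cong (φ (g zero) *_) (prodFin-tabulate k (λ i → g (suc i)))

  ⊠-as-∑ : ∀ (M N : Mould) {n} (F : Forest Ω n) →
    (M ⊠ N) F ≈ ∑ n (λ V → when (productAdmissible F V) (app M (F ∣ V) * app N (F ∣ ∁ V)))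
  ⊠-as-∑ M N {n} F = ≈trans (sumL-filterᵇ _ _ (allSubsets n)) (sumL-allSubsets n _)

  ⊚-as-∑ : ∀ (M N : Mould) {n} (F : Forest Ω n) →
    (M ⊚ N) F ≈ ∑ n (λ S → when (coverAdmissible F S) (compTerm M N F S))
  ⊚-as-∑ M N {n} F = ≈trans (sumL-filterᵇ _ _ (allSubsets n)) (sumL-allSubsets n _)

  ∑-size∣ : ∀ {n} (F : Forest Ω n) V (h : Subset (size∣ F V) → Carrier) →
        ∑ (size∣ F V) h ≈ ∑ n (λ X → when (X ⊆ᵇ V) (h (shrink∣ F V X)))
  ∑-size∣ ∅ [] h = ≈refl
  ∑-size∣ {suc n} (node ω p F) (true ∷ V) h =
    ≈trans (∑-size∣ F V _) (∑-cong n (λ X → when-+ (X ⊆ᵇ V) _ _))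
  ∑-size∣ {suc n} (node ω p F) (false ∷ V) h =
    ≈trans (∑-size∣ F V _) (∑-cong n (λ X → ≈sym (+-identityˡ _)))

  ∏-size∣ : ∀ {n} (F : Forest Ω n) V (φ : Fin (size∣ F V) → Carrier) → ∏ (size∣ F V) φ ≈ ∏ n (λ v → maybe¹ φ (embed∣ F V v))
  ∏-size∣ ∅ [] φ = ≈refl
  ∏-size∣ {suc n} (node ω p F) (true ∷ V) φ =
    *-congˡ (≈trans (∏-size∣ F V _) (∏-cong n (λ v → ≡⇒≈ (P.sym (maybe¹-suc φ (embed∣ F V v))))))
  ∏-size∣ {suc n} (node ω p F) (false ∷ V) φ = ≈trans (∏-size∣ F V φ) (≈sym (*-identityˡ _))

  ∑-size/ : ∀ {n} (F : Forest Ω n) S (h : Subset (size/ F S) → Carrier) →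
        ∑ (size/ F S) h ≈ ∑ n (λ X → when (X ⊆ᵇ heads F S) (h (shrink/ F S X)))
  ∑-size/ ∅ [] h = ≈refl
  ∑-size/ {suc n} (node ω (just q) F) (true ∷ S) h =
    ≈trans (∑-size/ F S h) (∑-cong n (λ X → ≈sym (+-identityˡ _)))
  ∑-size/ {suc n} (node ω nothing F) (true ∷ S) h =
    ≈trans (∑-size/ F S _) (∑-cong n (λ X → when-+ (X ⊆ᵇ heads F S) _ _))
  ∑-size/ {suc n} (node ω p F) (false ∷ S) h =
    ≈trans (∑-size/ F S _) (∑-cong n (λ X → when-+ (X ⊆ᵇ heads F S) _ _))

  ∑-saturate : ∀ {n} (F : Forest Ω n) S (φ : Subset n → Carrier) →
    ∑ n (λ X → when (X ⊆ᵇ heads F S) (φ (saturate F S X))) ≈ ∑ n (λ W → when (saturatedᵇ F S W) (φ W))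
  ∑-saturate ∅ [] φ = ≈refl
  ∑-saturate {suc n} (node ω p F) (false ∷ S) φ =
    ≈trans (∑-cong n (λ X → ≈sym (when-+ (X ⊆ᵇ heads F S) _ _)))
    (≈trans (∑-saturate F S (λ W → φ (true ∷ W) + φ (false ∷ W))) (∑-cong n (λ W → when-+ (saturatedᵇ F S W) _ _)))
  ∑-saturate {suc n} (node ω nothing F) (true ∷ S) φ =
    ≈trans (∑-cong n (λ X → ≈sym (when-+ (X ⊆ᵇ heads F S) _ _)))
    (≈trans (∑-saturate F S (λ W → φ (true ∷ W) + φ (false ∷ W))) (∑-cong n (λ W → when-+ (saturatedᵇ F S W) _ _)))
  ∑-saturate {suc n} (node ω (just q) F) (true ∷ S) φ =
    ≈trans (∑-cong n (λ X → +-identityˡ _)) (≈trans (∑-saturate F S (λ W → φ (lookup W q ∷ W))) (∑-cong n head-value))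
    where
      head-value : ∀ W → when (saturatedᵇ F S W) (φ (lookup W q ∷ W)) ≈
                 when (true ≡ᵇ lookup W q ∧ saturatedᵇ F S W) (φ (true ∷ W)) + when (false ≡ᵇ lookup W q ∧ saturatedᵇ F S W) (φ (false ∷ W))
      head-value W with lookup W q
      ... | true = ≈sym (+-identityʳ _)
      ... | false = ≈sym (+-identityˡ _)

  ∏-blocks-restrict : ∀ {n m k} (F : Forest Ω n) W (N : Mould) (f : Fin n → Fin m) (Y : Subset m)
    (ρ : Fin m → Maybe (Fin k)) (g : Fin (size∣ F W) → Fin k) →
    (∀ v → lookup W v ≡ lookup Y (f v)) →
    (∀ v → ρ (f v) ≡ Maybe.map g (embed∣ F W v)) →
    (∀ ψ → ∏ k ψ ≈ ∏ m (λ j → maybe¹ ψ (ρ j))) →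
    (∀ j → lookup Y j ≡ false → ρ j ≡ nothing) →
    (∀ j → lookup Y j ≡ true → Σ (Fin k) (λ j' → ρ j ≡ just j')) →
    (∀ a b c → ρ a ≡ just c → ρ b ≡ just c → a ≡ b) →
    ∏ k (λ j' → app N (forest∣ F W ∣ blockOf g j')) ≈ ∏ m (λ j → when¹ (lookup Y j) (app N (F ∣ blockOf f j)))
  ∏-blocks-restrict {n} {m} {k} F W N f Y ρ g W-lookup ρ∘f ∏-reindex ρ-outside ρ-inside ρ-injective = ≈trans (∏-reindex _) (∏-cong m factor)
    where
      factor : ∀ j → maybe¹ (λ j' → app N (forest∣ F W ∣ blockOf g j')) (ρ j) ≈ when¹ (lookup Y j) (app N (F ∣ blockOf f j))
      factor j with lookup Y j in j∈Y
      ... | false rewrite ρ-outside j j∈Y = ≈refl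
      ... | true with ρ-inside j j∈Y
      ...   | j' , ej rewrite ej = ≡⇒≈ (cong (app N) (P.trans (cong (forest∣ F W ∣_) block-eq)
                                         (P.trans (∣-∣ F W (blockOf f j)) (cong (F ∣_) (∩-⊇ W _ block⊆W)))))
        where
          block-eq : blockOf g j' ≡ shrink∣ F W (blockOf f j)
          block-eq = lookup-extensionality _ _ λ x → let (v , ev) = embed∣-surjective F W x in
            P.trans (lookup-blockOf g j' x)
             (P.trans (does-≟-cong {a = g x} {b = j'} {c = f v} {d = j}
                         (λ gx → ρ-injective (f v) j j' (P.trans (ρ∘f v) (P.trans (cong (Maybe.map g) ev) (cong just gx))) ej)
                         (λ fv → just-injective (P.trans (P.sym (P.trans (cong (Maybe.map g) ev) refl))
                                            (P.trans (P.sym (ρ∘f v)) (P.trans (cong ρ fv) ej)))))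
             (P.sym (P.trans (lookup-shrink∣ F W (blockOf f j) v x ev) (lookup-blockOf f j v))))
          block⊆W : ∀ v → lookup (blockOf f j) v ≡ true → lookup W v ≡ true
          block⊆W v e = P.trans (W-lookup v) (P.trans (cong (lookup Y) (does-≟⇒≡ (P.trans (P.sym (lookup-blockOf f j v)) e))) j∈Y)

  ∏-blocks-restrict-quotient : ∀ {n} (F : Forest Ω n) S (Y : Subset (size/ F S)) W (N : Mould) → (∀ v → lookup W v ≡ lookup Y (block/ F S v)) →
    ∏ (size/ (forest∣ F W) (shrink∣ F W S)) (λ j' → app N (forest∣ F W ∣ blockOf (block/ (forest∣ F W) (shrink∣ F W S)) j'))
      ≈ ∏ (size/ F S) (λ j → when¹ (lookup Y j) (app N (F ∣ blockOf (block/ F S) j)))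
  ∏-blocks-restrict-quotient F S Y W N W-lookup
    with restrict (forest/ F S) Y | quotient (forest∣ F W) (shrink∣ F W S) | restrict-quotient F S Y W W-lookup | ∏-size∣ (forest/ F S) Y
       | embed∣-outside (forest/ F S) Y | embed∣-inside (forest/ F S) Y | embed∣-injective (forest/ F S) Y
  ... | k , G , ρ | _ | restrictsQuotient ρ∘block | ∏-reindex | ρ-outside | ρ-inside | ρ-injective = ∏-blocks-restrict F W N (block/ F S) Y ρ _ W-lookup ρ∘block ∏-reindex ρ-outside ρ-inside ρ-injective

  ε-empty : ∀ (x : Σ ℕ (Forest Ω)) → proj₁ x ≡ 0 → app ε x ≡ 1#
  ε-empty (zero , G) e = refl

  ε-nonempty : ∀ (x : Σ ℕ (Forest Ω)) k → proj₁ x ≡ suc k → app ε x ≡ 0#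
  ε-nonempty (suc _ , G) k e = refl

  I<-≥2 : ∀ (x : Σ ℕ (Forest Ω)) k → proj₁ x ≡ suc (suc k) → app I< x ≡ 0#
  I<-≥2 (suc (suc _) , G) k e = refl

  I<-single : ∀ (x : Σ ℕ (Forest Ω)) → proj₁ x ≡ 1 → app I< x ≡ 1#
  I<-single (suc zero , G) e = refl

  ⊠-identityˡ : ∀ (M : Mould) → (ε ⊠ M) ≋ M
  ⊠-identityˡ M {n} F = ≈trans (⊠-as-∑ ε M F) (≈trans (∑-supported-on-∅ n _ nonempty-vanishes) ∅-term)
    where
      nonempty-vanishes : ∀ V → isEmptyᵇ V ≡ false → when (productAdmissible F V) (app ε (F ∣ V) * app M (F ∣ ∁ V)) ≈ 0#
      nonempty-vanishes V e with size∣-nonempty F V e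
      ... | k , e2 rewrite ε-nonempty (F ∣ V) k e2 = ≈trans (when-cong (productAdmissible F V) (zeroˡ _)) (when-0 (productAdmissible F V))
      ∅-term : when (productAdmissible F (replicate n false)) (app ε (F ∣ replicate n false) * app M (F ∣ ∁ (replicate n false))) ≈ M F
      ∅-term rewrite productAdmissible-∅ F | ε-empty (F ∣ replicate n false) (size∣-∅ F) | ∁-∅ n = ≈trans (*-identityˡ _) (≡⇒≈ (cong (app M) (∣-full F)))

  ⊠-identityʳ : ∀ (M : Mould) → (M ⊠ ε) ≋ M
  ⊠-identityʳ M {n} F = ≈trans (⊠-as-∑ M ε F) (≈trans (∑-∁ n _) (≈trans (∑-supported-on-∅ n _ nonempty-vanishes) ∅-term))
    where
      nonempty-vanishes : ∀ V → isEmptyᵇ V ≡ false → when (productAdmissible F (∁ V)) (app M (F ∣ ∁ V) * app ε (F ∣ ∁ (∁ V))) ≈ 0#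
      nonempty-vanishes V e with size∣-nonempty F V e
      ... | k , e2 rewrite ∁-involutive V | ε-nonempty (F ∣ V) k e2 = ≈trans (when-cong (productAdmissible F (∁ V)) (zeroʳ _)) (when-0 (productAdmissible F (∁ V)))
      ∅-term : when (productAdmissible F (∁ (replicate n false))) (app M (F ∣ ∁ (replicate n false)) * app ε (F ∣ ∁ (∁ (replicate n false)))) ≈ M F
      ∅-term rewrite ∁-involutive (replicate n false) | ∁-∅ n | productAdmissible-full F | ε-empty (F ∣ replicate n false) (size∣-∅ F) = ≈trans (*-identityʳ _) (≡⇒≈ (cong (app M) (∣-full F)))

  module ProductAssociativity (M M′ M″ : Mould) {n} (F : Forest Ω n) where

    termˡ : Subset n → Subset n → Carrier
    termˡ X V = when (downClosedᵇ F V) (when (downClosedᵇ F X) (app M (F ∣ X) * app M′ (F ∣ (V ∩ ∁ X))) * app M″ (F ∣ ∁ V))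

    termʳ : Subset n → Subset n → Carrier
    termʳ V Y = when (downClosedᵇ F V) (app M (F ∣ V) * when (downClosedᵇ F (V ∪ Y)) (app M′ (F ∣ Y) * app M″ (F ∣ ∁ (V ∪ Y))))

    innerˡ : Subset n → Subset n → Carrier
    innerˡ V X = when (productAdmissible (forest∣ F V) (shrink∣ F V X))
                      (app M (forest∣ F V ∣ shrink∣ F V X) * app M′ (forest∣ F V ∣ ∁ (shrink∣ F V X)))

    innerʳ : Subset n → Subset n → Carrier
    innerʳ V Y = when (productAdmissible (forest∣ F (∁ V)) (shrink∣ F (∁ V) Y))
                      (app M′ (forest∣ F (∁ V) ∣ shrink∣ F (∁ V) Y) * app M″ (forest∣ F (∁ V) ∣ ∁ (shrink∣ F (∁ V) Y)))

    innerˡ≈termˡ : ∀ V X → when (productAdmissible F V) (when (X ⊆ᵇ V) (innerˡ V X) * app M″ (F ∣ ∁ V)) ≈ when (X ⊆ᵇ V) (termˡ X V)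
    innerˡ≈termˡ V X rewrite productAdmissible≡downClosedᵇ F V with X ⊆ᵇ V in X⊆V | downClosedᵇ F V in V↓
    ... | false | b = ≈trans (when-cong b (zeroˡ _)) (when-0 b)
    ... | true | false = ≈refl
    ... | true | true = *-congʳ inner≈
      where
        M-eq : app M (forest∣ F V ∣ shrink∣ F V X) ≡ app M (F ∣ X)
        M-eq = P.trans (cong (app M) (∣-∣ F V X)) (cong (λ Z → app M (F ∣ Z)) (∩-⊆ᵇ X V X⊆V))
        M′-eq : app M′ (forest∣ F V ∣ ∁ (shrink∣ F V X)) ≡ app M′ (F ∣ (V ∩ ∁ X))
        M′-eq = P.trans (cong (λ Z → app M′ (forest∣ F V ∣ Z)) (∁-shrink∣ F V X)) (cong (app M′) (∣-∣ F V (∁ X)))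
        inner≈ : innerˡ V X ≈ when (downClosedᵇ F X) (app M (F ∣ X) * app M′ (F ∣ (V ∩ ∁ X)))
        inner≈ rewrite productAdmissible≡downClosedᵇ (forest∣ F V) (shrink∣ F V X) | downClosedᵇ-restrict-⊆ F V X X⊆V V↓ =
          when-cong (downClosedᵇ F X) (*-cong (≡⇒≈ M-eq) (≡⇒≈ M′-eq))

    innerʳ≈termʳ : ∀ V Y → when (productAdmissible F V) (app M (F ∣ V) * when (Y ⊆ᵇ ∁ V) (innerʳ V Y)) ≈ when (disjointᵇ V Y) (termʳ V Y)
    innerʳ≈termʳ V Y rewrite productAdmissible≡downClosedᵇ F V | ⊆ᵇ∁≡disjointᵇ V Y with disjointᵇ V Y in V#Y | downClosedᵇ F V in V↓
    ... | false | b = ≈trans (when-cong b (zeroʳ _)) (when-0 b)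
    ... | true | false = ≈refl
    ... | true | true = *-congˡ inner≈
      where
        M′-eq : app M′ (forest∣ F (∁ V) ∣ shrink∣ F (∁ V) Y) ≡ app M′ (F ∣ Y)
        M′-eq = P.trans (cong (app M′) (∣-∣ F (∁ V) Y)) (cong (λ Z → app M′ (F ∣ Z)) (∁∩-disjointᵇ V Y V#Y))
        M″-eq : app M″ (forest∣ F (∁ V) ∣ ∁ (shrink∣ F (∁ V) Y)) ≡ app M″ (F ∣ ∁ (V ∪ Y))
        M″-eq = P.trans (cong (λ Z → app M″ (forest∣ F (∁ V) ∣ Z)) (∁-shrink∣ F (∁ V) Y))
                  (P.trans (cong (app M″) (∣-∣ F (∁ V) (∁ Y))) (cong (λ Z → app M″ (F ∣ Z)) (∁∩∁ V Y)))
        inner≈ : innerʳ V Y ≈ when (downClosedᵇ F (V ∪ Y)) (app M′ (F ∣ Y) * app M″ (F ∣ ∁ (V ∪ Y)))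
        inner≈ rewrite productAdmissible≡downClosedᵇ (forest∣ F (∁ V)) (shrink∣ F (∁ V) Y) | downClosedᵇ-restrict-∁ F V Y V#Y V↓ =
          when-cong (downClosedᵇ F (V ∪ Y)) (*-cong (≡⇒≈ M′-eq) (≡⇒≈ M″-eq))

    expansionˡ : ((M ⊠ M′) ⊠ M″) F ≈ ∑ n (λ V → ∑ n (λ X → when (X ⊆ᵇ V) (termˡ X V)))
    expansionˡ = ≈trans (⊠-as-∑ (M ⊠ M′) M″ F) (∑-cong n expand)
      where
        expand : ∀ V → when (productAdmissible F V) (app (M ⊠ M′) (F ∣ V) * app M″ (F ∣ ∁ V)) ≈ ∑ n (λ X → when (X ⊆ᵇ V) (termˡ X V))
        expand V = ≈trans (when-cong (productAdmissible F V) (*-congʳ (≈trans (⊠-as-∑ M M′ (forest∣ F V)) (∑-size∣ F V _))))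
                   (≈trans (when-cong (productAdmissible F V) (∑-distribʳ n _ _))
                   (≈trans (when-∑ (productAdmissible F V) n _)
                   (∑-cong n (innerˡ≈termˡ V))))

    expansionʳ : (M ⊠ (M′ ⊠ M″)) F ≈ ∑ n (λ V → ∑ n (λ Y → when (disjointᵇ V Y) (termʳ V Y)))
    expansionʳ = ≈trans (⊠-as-∑ M (M′ ⊠ M″) F) (∑-cong n expand)
      where
        expand : ∀ V → when (productAdmissible F V) (app M (F ∣ V) * app (M′ ⊠ M″) (F ∣ ∁ V)) ≈ ∑ n (λ Y → when (disjointᵇ V Y) (termʳ V Y))
        expand V = ≈trans (when-cong (productAdmissible F V) (*-congˡ (≈trans (⊠-as-∑ M′ M″ (forest∣ F (∁ V))) (∑-size∣ F (∁ V) _))))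
                   (≈trans (when-cong (productAdmissible F V) (∑-distribˡ n _ _))
                   (≈trans (when-∑ (productAdmissible F V) n _)
                   (∑-cong n (innerʳ≈termʳ V))))

    termˡ≈termʳ : ∀ A B → when (disjointᵇ A B) (termˡ A (A ∪ B)) ≈ when (disjointᵇ A B) (termʳ A B)
    termˡ≈termʳ A B with disjointᵇ A B in A#B
    ... | false = ≈refl
    ... | true rewrite ∪∩∁-disjointᵇ A B A#B with downClosedᵇ F A | downClosedᵇ F (A ∪ B)
    ...   | true  | true  = *-assoc _ _ _
    ...   | true  | false = ≈sym (zeroʳ _)
    ...   | false | true  = zeroˡ _
    ...   | false | false = ≈refl

  ⊠-assoc : ∀ (M M′ M″ : Mould) → ((M ⊠ M′) ⊠ M″) ≋ (M ⊠ (M′ ⊠ M″))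
  ⊠-assoc M M′ M″ {n} F = begin
    ((M ⊠ M′) ⊠ M″) F                                                  ≈⟨ expansionˡ ⟩
    ∑ n (λ V → ∑ n (λ X → when (X ⊆ᵇ V) (termˡ X V)))                  ≈⟨ ∑-nested-⊆ᵇ n termˡ ⟩
    ∑ n (λ A → ∑ n (λ B → when (disjointᵇ A B) (termˡ A (A ∪ B))))    ≈⟨ ∑-cong n (λ A → ∑-cong n (termˡ≈termʳ A)) ⟩
    ∑ n (λ A → ∑ n (λ B → when (disjointᵇ A B) (termʳ A B)))           ≈⟨ expansionʳ ⟨
    (M ⊠ (M′ ⊠ M″)) F                                                  ∎
    where open ProductAssociativity M M′ M″ F

  I<-block-of-kept-edge : ∀ {n} (F : Forest Ω n) S v → coverᵇ F S ≡ true → lookup S v ≡ true →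
    app I< (F ∣ blockOf (block/ F S) (block/ F S v)) ≈ 0#
  I<-block-of-kept-edge F S v S-cover v∈S
    with blockmate F S v S-cover v∈S
  ... | u , same-block , u≢v
    with size∣-≥2 F (blockOf (block/ F S) (block/ F S v)) u v
           (P.trans (lookup-blockOf (block/ F S) _ u) (P.trans (cong (λ x → does (x ≟ block/ F S v)) (P.sym same-block)) (≟-refl (block/ F S v))))
           (P.trans (lookup-blockOf (block/ F S) _ v) (≟-refl (block/ F S v))) u≢v
  ... | k , size≡ = ≡⇒≈ (I<-≥2 (F ∣ blockOf (block/ F S) (block/ F S v)) k size≡)

  compTerm-I<-nonempty : ∀ (M : Mould) {n} (F : Forest Ω n) S → isEmptyᵇ S ≡ false →
    when (coverAdmissible F S) (compTerm M I< F S) ≈ 0#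
  compTerm-I<-nonempty M F S S≢∅ rewrite coverAdmissible≡coverᵇ F S with coverᵇ F S in S-cover
  ... | false = ≈refl
  ... | true with nonEmpty-witness S S≢∅
  ...   | v , v∈S =
    ≈trans (*-congˡ (≈trans (≡⇒≈ (prodFin≡∏ (size/ F S) _))
                            (∏-zero (size/ F S) _ (block/ F S v) (I<-block-of-kept-edge F S v S-cover v∈S))))
           (zeroʳ _)

  compTerm-I<-∅ : ∀ (M : Mould) {n} (F : Forest Ω n) →
    when (coverAdmissible F (replicate n false)) (compTerm M I< F (replicate n false)) ≈ M F
  compTerm-I<-∅ M {n} F rewrite coverAdmissible≡coverᵇ F (replicate n false) | coverᵇ-∅ F
    with quotient F (replicate n false) | quotient-∅ F
  ... | .(n , F , f) | f , refl , f≗id =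
    ≈trans (*-congˡ (≈trans (≡⇒≈ (prodFin≡∏ n _)) (∏-one n _ singleton-blocks))) (*-identityʳ _)
    where
      singleton-blocks : ∀ j → app I< (F ∣ blockOf f j) ≈ 1#
      singleton-blocks j = ≡⇒≈ (I<-single (F ∣ blockOf f j)
        (size∣-singleton F (blockOf f j) j (λ v → P.trans (lookup-blockOf f j v) (cong (λ x → does (x ≟ j)) (f≗id v)))))

  ⊚-identityʳ : ∀ (M : Mould) → (M ⊚ I<) ≋ M
  ⊚-identityʳ M {n} F =
    ≈trans (⊚-as-∑ M I< F) (≈trans (∑-supported-on-∅ n _ (compTerm-I<-nonempty M F)) (compTerm-I<-∅ M F))

  module CompositionDistributivity (M M′ N : Mould) {n} (F : Forest Ω n) where

    productOn/ : ∀ S → Subset (size/ F S) → Carrier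
    productOn/ S Y = when (productAdmissible (forest/ F S) Y) (app M (forest/ F S ∣ Y) * app M′ (forest/ F S ∣ ∁ Y))

    N-on-block : ∀ S → Fin (size/ F S) → Carrier
    N-on-block S j = app N (F ∣ blockOf (block/ F S) j)

    termˡ : Subset n → Subset n → Carrier
    termˡ S W = when (coverAdmissible F S) (when (saturatedᵇ F S W) (productOn/ S (shrink/ F S W)) * ∏ (size/ F S) (N-on-block S))

    termʳ : Subset n → Subset n → Carrier
    termʳ W S = when (productAdmissible F W)
      (when (coverAdmissible (forest∣ F W) (shrink∣ F W S)) (compTerm M N (forest∣ F W) (shrink∣ F W S))
       * when (coverAdmissible (forest∣ F (∁ W)) (shrink∣ F (∁ W) S)) (compTerm M′ N (forest∣ F (∁ W)) (shrink∣ F (∁ W) S)))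

    expansionˡ : ((M ⊠ M′) ⊚ N) F ≈ ∑ n (λ S → ∑ n (λ W → termˡ S W))
    expansionˡ = ≈trans (⊚-as-∑ (M ⊠ M′) N F) (∑-cong n expand)
      where
        product/≈∑saturated : ∀ S → (M ⊠ M′) (forest/ F S) ≈ ∑ n (λ W → when (saturatedᵇ F S W) (productOn/ S (shrink/ F S W)))
        product/≈∑saturated S =
          ≈trans (⊠-as-∑ M M′ (forest/ F S))
          (≈trans (∑-size/ F S (productOn/ S))
          (≈trans (∑-cong n (λ X → when-cong (X ⊆ᵇ heads F S) (≡⇒≈ (cong (productOn/ S) (P.sym (shrink/-saturate F S X))))))
                  (∑-saturate F S (λ W → productOn/ S (shrink/ F S W)))))
        expand : ∀ S → when (coverAdmissible F S) (compTerm (M ⊠ M′) N F S) ≈ ∑ n (termˡ S)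
        expand S =
          ≈trans (when-cong (coverAdmissible F S) (*-cong (product/≈∑saturated S) (≡⇒≈ (prodFin≡∏ (size/ F S) (N-on-block S)))))
          (≈trans (when-cong (coverAdmissible F S) (∑-distribʳ n _ _))
                  (when-∑ (coverAdmissible F S) n _))

    expansionʳ : ((M ⊚ N) ⊠ (M′ ⊚ N)) F ≈ ∑ n (λ W → ∑ n (λ S → termʳ W S))
    expansionʳ = ≈trans (⊠-as-∑ (M ⊚ N) (M′ ⊚ N) F) (∑-cong n expand)
      where
        expand : ∀ W → when (productAdmissible F W) (app (M ⊚ N) (F ∣ W) * app (M′ ⊚ N) (F ∣ ∁ W)) ≈ ∑ n (termʳ W)
        expand W =
          ≈trans (when-cong (productAdmissible F W)
                    (≈trans (*-cong (≈trans (⊚-as-∑ M N (forest∣ F W)) (∑-size∣ F W _))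
                                    (≈trans (⊚-as-∑ M′ N (forest∣ F (∁ W))) (∑-size∣ F (∁ W) _)))
                    (≈trans (∑⊆-*-∑⊆∁ n W _ _)
                            (∑-cong n (λ S → ≡⇒≈ (cong₂ (λ A B → when (coverAdmissible (forest∣ F W) A) (compTerm M N (forest∣ F W) A)
                                                                 * when (coverAdmissible (forest∣ F (∁ W)) B) (compTerm M′ N (forest∣ F (∁ W)) B))
                                                         (shrink∣-∩ F W S) (shrink∣-∩ F (∁ W) S)))))))
          (when-∑ (productAdmissible F W) n _)

    termˡ-vanishes : ∀ W S → coverᵇ F S ∧ saturatedᵇ F S W ≡ false → termˡ S W ≈ 0#
    termˡ-vanishes W S e rewrite coverAdmissible≡coverᵇ F S with coverᵇ F S | saturatedᵇ F S W | e
    ... | false | _     | _ = ≈refl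
    ... | true  | false | _ = zeroˡ _

    termʳ-vanishes : ∀ W S → coverᵇ (forest∣ F W) (shrink∣ F W S) ∧ coverᵇ (forest∣ F (∁ W)) (shrink∣ F (∁ W) S) ≡ false → termʳ W S ≈ 0#
    termʳ-vanishes W S e rewrite coverAdmissible≡coverᵇ (forest∣ F W) (shrink∣ F W S) | coverAdmissible≡coverᵇ (forest∣ F (∁ W)) (shrink∣ F (∁ W) S)
      with coverᵇ (forest∣ F W) (shrink∣ F W S) | coverᵇ (forest∣ F (∁ W)) (shrink∣ F (∁ W) S) | e
    ... | false | _     | _ = ≈trans (when-cong (productAdmissible F W) (zeroˡ _)) (when-0 (productAdmissible F W))
    ... | true  | false | _ = ≈trans (when-cong (productAdmissible F W) (zeroʳ _)) (when-0 (productAdmissible F W))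

    module _ (S W : Subset n) (W-saturated : saturatedᵇ F S W ≡ true) where

      W-lookup : ∀ v → lookup W v ≡ lookup (shrink/ F S W) (block/ F S v)
      W-lookup = saturated-lookup F S W W-saturated

      ∁W-lookup : ∀ v → lookup (∁ W) v ≡ lookup (shrink/ F S (∁ W)) (block/ F S v)
      ∁W-lookup = saturated-lookup F S (∁ W) (P.trans (saturatedᵇ-∁ F S W) W-saturated)

      M-on-quotient : app M (forest/ F S ∣ shrink/ F S W) ≡ M (forest/ (forest∣ F W) (shrink∣ F W S))
      M-on-quotient = cong (app M) (restrict-quotient-forest F S (shrink/ F S W) W W-lookup)

      M′-on-quotient : app M′ (forest/ F S ∣ ∁ (shrink/ F S W)) ≡ M′ (forest/ (forest∣ F (∁ W)) (shrink∣ F (∁ W) S))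
      M′-on-quotient = P.trans (cong (λ Z → app M′ (forest/ F S ∣ Z)) (P.sym (shrink/-∁ F S W)))
                               (cong (app M′) (restrict-quotient-forest F S (shrink/ F S (∁ W)) (∁ W) ∁W-lookup))

      N-on-blocks-inside : ∀ {V} → (∀ v → lookup V v ≡ lookup (shrink/ F S V) (block/ F S v)) →
        prodFin (size/ (forest∣ F V) (shrink∣ F V S)) (λ j → app N (forest∣ F V ∣ blockOf (block/ (forest∣ F V) (shrink∣ F V S)) j))
          ≈ ∏ (size/ F S) (λ j → when¹ (lookup (shrink/ F S V) j) (N-on-block S j))
      N-on-blocks-inside {V} V-lookup =
        ≈trans (≡⇒≈ (prodFin≡∏ (size/ (forest∣ F V) (shrink∣ F V S)) _)) (∏-blocks-restrict-quotient F S (shrink/ F S V) V N V-lookup)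

      termˡ≈termʳ-covers : coverᵇ F S ≡ true → coverᵇ (forest∣ F W) (shrink∣ F W S) ≡ true →
        coverᵇ (forest∣ F (∁ W)) (shrink∣ F (∁ W) S) ≡ true → termˡ S W ≈ termʳ W S
      termˡ≈termʳ-covers S-cover S∣W-cover S∣∁W-cover
        rewrite coverAdmissible≡coverᵇ F S | S-cover | W-saturated
              | coverAdmissible≡coverᵇ (forest∣ F W) (shrink∣ F W S) | S∣W-cover
              | coverAdmissible≡coverᵇ (forest∣ F (∁ W)) (shrink∣ F (∁ W) S) | S∣∁W-cover
              | productAdmissible≡downClosedᵇ F W | productAdmissible≡downClosedᵇ (forest/ F S) (shrink/ F S W)
              | downClosedᵇ-quotient F S W S-cover W-saturated
        with downClosedᵇ F W
      ... | false = zeroˡ _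
      ... | true =
        ≈trans (*-cong (*-cong (≡⇒≈ M-on-quotient) (≡⇒≈ M′-on-quotient)) (∏-split (size/ F S) (shrink/ F S W) (N-on-block S)))
        (≈trans (*P.interchange _ _ _ _)
                (≈sym (*-cong (*-congˡ (N-on-blocks-inside W-lookup))
                              (*-congˡ (≈trans (N-on-blocks-inside ∁W-lookup)
                                               (≡⇒≈ (cong (λ Z → ∏ (size/ F S) (λ j → when¹ (lookup Z j) (N-on-block S j))) (shrink/-∁ F S W))))))))

    termˡ≈termʳ : ∀ W S → termˡ S W ≈ termʳ W S
    termˡ≈termʳ W S with coverᵇ F S ∧ saturatedᵇ F S W in S-cover∧W-saturated
    ... | false = ≈trans (termˡ-vanishes W S S-cover∧W-saturated)
                         (≈sym (termʳ-vanishes W S (P.trans (coverᵇ-split F S W) S-cover∧W-saturated)))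
    ... | true = termˡ≈termʳ-covers S W (∧-projʳ (coverᵇ F S) _ S-cover∧W-saturated)
                   (∧-projˡ _ _ S-cover∧W-saturated)
                   (∧-projˡ _ _ restricted-covers)
                   (∧-projʳ (coverᵇ (forest∣ F W) (shrink∣ F W S)) _ restricted-covers)
      where restricted-covers = P.trans (coverᵇ-split F S W) S-cover∧W-saturated

  ⊚-distribʳ-⊠ : ∀ (M M′ N : Mould) → ((M ⊠ M′) ⊚ N) ≋ ((M ⊚ N) ⊠ (M′ ⊚ N))
  ⊚-distribʳ-⊠ M M′ N {n} F = begin
    ((M ⊠ M′) ⊚ N) F                          ≈⟨ expansionˡ ⟩
    ∑ n (λ S → ∑ n (λ W → termˡ S W))         ≈⟨ ∑-comm n n termˡ ⟩
    ∑ n (λ W → ∑ n (λ S → termˡ S W))         ≈⟨ ∑-cong n (λ W → ∑-cong n (termˡ≈termʳ W)) ⟩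
    ∑ n (λ W → ∑ n (λ S → termʳ W S))         ≈⟨ expansionʳ ⟨
    ((M ⊚ N) ⊠ (M′ ⊚ N)) F                    ∎
    where open CompositionDistributivity M M′ N F

  compTerm-assoc : ∀ {n} (F : Forest Ω n) S (M M′ M″ : Mould) (m : ℕ) (Q : Forest Ω m) (g : Fin (size/ F S) → Fin m) (f : Fin n → Fin m) →
    (∀ i → g (block/ F S i) ≡ f i) →
    (M Q * ∏ m (λ k → app M′ (forest/ F S ∣ blockOf g k))) * ∏ (size/ F S) (λ j → app M″ (F ∣ blockOf (block/ F S) j))
      ≈ M Q * ∏ m (λ k → compTerm M′ M″ (forest∣ F (blockOf f k)) (shrink∣ F (blockOf f k) S))
  compTerm-assoc F S M M′ M″ m Q g f g∘block≗f = ≈trans (*-assoc _ _ _) (*-congˡ (≈trans (*-cong (∏-cong m M′-eq) M″-eq) (≈sym (∏-* m _ _))))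
    where
      M″-on-block : Fin (size/ F S) → Carrier
      M″-on-block j = app M″ (F ∣ blockOf (block/ F S) j)
      fibre-lookup : ∀ k v → lookup (blockOf f k) v ≡ lookup (blockOf g k) (block/ F S v)
      fibre-lookup k v = P.trans (lookup-blockOf f k v)
        (P.trans (cong (λ z → does (z ≟ k)) (P.sym (g∘block≗f v))) (P.sym (lookup-blockOf g k (block/ F S v))))
      M′-eq : ∀ k → app M′ (forest/ F S ∣ blockOf g k) ≈ M′ (forest/ (forest∣ F (blockOf f k)) (shrink∣ F (blockOf f k) S))
      M′-eq k = ≡⇒≈ (cong (app M′) (restrict-quotient-forest F S (blockOf g k) (blockOf f k) (fibre-lookup k)))
      M″-eq : ∏ (size/ F S) M″-on-block
        ≈ ∏ m (λ k → prodFin (size/ (forest∣ F (blockOf f k)) (shrink∣ F (blockOf f k) S))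
                             (λ j → app M″ (forest∣ F (blockOf f k) ∣ blockOf (block/ (forest∣ F (blockOf f k)) (shrink∣ F (blockOf f k) S)) j)))
      M″-eq = ≈sym (≈trans
        (∏-cong m (λ k → ≈trans (≡⇒≈ (prodFin≡∏ (size/ (forest∣ F (blockOf f k)) (shrink∣ F (blockOf f k) S)) _))
                         (≈trans (∏-blocks-restrict-quotient F S (blockOf g k) (blockOf f k) M″ (fibre-lookup k))
                                 (∏-cong (size/ F S) (λ j → ≡⇒≈ (cong (λ b → when¹ b (M″-on-block j)) (lookup-blockOf g k j)))))))
        (≈trans (∏-comm m (size/ F S) (λ k j → when¹ (does (g j ≟ k)) (M″-on-block j)))
                (∏-cong (size/ F S) (λ j → ∏-when¹-≟ m (g j) (M″-on-block j)))))

  module CompositionAssociativity (M M′ M″ : Mould) {n} (F : Forest Ω n) where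

    M″-on-block : ∀ S → Fin (size/ F S) → Carrier
    M″-on-block S j = app M″ (F ∣ blockOf (block/ F S) j)

    block : ∀ U → Fin (size/ F U) → Subset n
    block U k = blockOf (block/ F U) k

    innerˡ : Subset n → Subset n → Carrier
    innerˡ S X = when (coverAdmissible (forest/ F S) (shrink/ F S X)) (compTerm M M′ (forest/ F S) (shrink/ F S X))

    summandˡ : Subset n → Subset n → Carrier
    summandˡ S X = when (coverAdmissible F S) (when (X ⊆ᵇ heads F S) (innerˡ S X) * ∏ (size/ F S) (M″-on-block S))

    termˡ : Subset n → Subset n → Carrier
    termˡ S U = when (coverAdmissible F S) (innerˡ S (U ∩ ∁ S) * ∏ (size/ F S) (M″-on-block S))

    innerʳ : ∀ U → Fin (size/ F U) → Subset n → Carrier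
    innerʳ U k Z = when (coverAdmissible (forest∣ F (block U k)) (shrink∣ F (block U k) Z)) (compTerm M′ M″ (forest∣ F (block U k)) (shrink∣ F (block U k) Z))

    termʳ : Subset n → Subset n → Carrier
    termʳ U S = when (coverAdmissible F U) (M (forest/ F U) * ∏ (size/ F U) (λ k → innerʳ U k S))

    expansionˡ : ((M ⊚ M′) ⊚ M″) F ≈ ∑ n (λ S → ∑ n (λ X → summandˡ S X))
    expansionˡ = ≈trans (⊚-as-∑ (M ⊚ M′) M″ F) (∑-cong n expand)
      where
        expand : ∀ S → when (coverAdmissible F S) (compTerm (M ⊚ M′) M″ F S) ≈ ∑ n (summandˡ S)
        expand S =
          ≈trans (when-cong (coverAdmissible F S)
                    (*-cong (≈trans (⊚-as-∑ M M′ (forest/ F S)) (∑-size/ F S _)) (≡⇒≈ (prodFin≡∏ (size/ F S) (M″-on-block S)))))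
          (≈trans (when-cong (coverAdmissible F S) (∑-distribʳ n _ _))
                  (when-∑ (coverAdmissible F S) n _))

    expansionʳ : (M ⊚ (M′ ⊚ M″)) F ≈ ∑ n (λ U → ∑ n (λ S → termʳ U S))
    expansionʳ = ≈trans (⊚-as-∑ M (M′ ⊚ M″) F) (∑-cong n expand)
      where
        blocks-disjoint : ∀ U v k k′ → lookup (block U k) v ≡ true → lookup (block U k′) v ≡ true → k ≡ k′
        blocks-disjoint U v k k′ a b =
          P.trans (P.sym (does-≟⇒≡ {a = block/ F U v} {b = k} (P.trans (P.sym (lookup-blockOf (block/ F U) k v)) a)))
                  (does-≟⇒≡ {a = block/ F U v} {b = k′} (P.trans (P.sym (lookup-blockOf (block/ F U) k′ v)) b))
        blocks-cover : ∀ U v → lookup (⋃ (size/ F U) (block U)) v ≡ true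
        blocks-cover U v = ∈-⋃⁺ (size/ F U) (block U) (block/ F U v) v (P.trans (lookup-blockOf (block/ F U) _ v) (≟-refl (block/ F U v)))
        expand : ∀ U → when (coverAdmissible F U) (compTerm M (M′ ⊚ M″) F U) ≈ ∑ n (termʳ U)
        expand U =
          ≈trans (when-cong (coverAdmissible F U)
            (*-congˡ (≈trans (≡⇒≈ (prodFin≡∏ (size/ F U) (λ k → app (M′ ⊚ M″) (F ∣ block U k))))
                     (≈trans (∏-cong (size/ F U) (λ k → ≈trans (⊚-as-∑ M′ M″ (forest∣ F (block U k))) (∑-size∣ F (block U k) _)))
                     (≈trans (∏∑⊆-disjoint n (size/ F U) (block U) (innerʳ U) (blocks-disjoint U))
                     (∑-cong n (λ S → ≈trans (when-true _ (⊆ᵇ-full S _ (blocks-cover U)))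
                        (∏-cong (size/ F U) (λ k → ≡⇒≈ (cong (λ Z → when (coverAdmissible (forest∣ F (block U k)) Z) (compTerm M′ M″ (forest∣ F (block U k)) Z))
                                                            (shrink∣-∩ F (block U k) S)))))))))))
          (≈trans (when-cong (coverAdmissible F U) (∑-distribˡ n _ _)) (when-∑ (coverAdmissible F U) n _))

    summandˡ≈termˡ : ∀ S X → summandˡ S X ≈ when (disjointᵇ S X) (termˡ S (S ∪ X))
    summandˡ≈termˡ S X rewrite coverAdmissible≡coverᵇ F S with coverᵇ F S in S-cover
    ... | false = ≈sym (when-0 (disjointᵇ S X))
    ... | true rewrite ⊆ᵇheads≡disjointᵇ F S X S-cover with disjointᵇ S X in S#X
    ...   | false = zeroˡ _
    ...   | true rewrite ∪∩∁-disjointᵇ S X S#X = ≈refl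

    termʳ-vanishes : ∀ U S → S ⊆ᵇ U ≡ false → termʳ U S ≈ 0#
    termʳ-vanishes U S S⊈U rewrite coverAdmissible≡coverᵇ F U with coverᵇ F U
    ... | false = ≈refl
    ... | true with coverᵇ-some-block F S U S⊈U
    ...   | k , not-cover =
      ≈trans (*-congˡ (∏-zero (size/ F U) (λ k → innerʳ U k S) k
                (≡⇒≈ (cong (λ b → when b (compTerm M′ M″ (forest∣ F (block U k)) (shrink∣ F (block U k) S)))
                           (P.trans (coverAdmissible≡coverᵇ (forest∣ F (block U k)) (shrink∣ F (block U k) S)) not-cover)))))
             (zeroʳ _)

    compTerm-quotient≈termʳ : ∀ U S → S ⊆ᵇ U ≡ true →
      compTerm M M′ (forest/ F S) (shrink/ F S (U ∩ ∁ S)) * ∏ (size/ F S) (M″-on-block S)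
        ≈ M (forest/ F U) * ∏ (size/ F U) (λ k → compTerm M′ M″ (forest∣ F (block U k)) (shrink∣ F (block U k) S))
    compTerm-quotient≈termʳ U S S⊆U
      with quotient (forest/ F S) (shrink/ F S (U ∩ ∁ S)) | quotient F U
         | P.subst (λ Z → SameQuotient (quotient F S ∘ᵠ quotient (forest/ F S) (shrink/ F S (U ∩ ∁ S))) (quotient F Z))
                   (∪-∩∁-⊆ᵇ S U S⊆U) (quotient-quotient F S (U ∩ ∁ S))
    ... | m , Q , g | _ | sameQuotient g∘block≗f =
      ≈trans (*-congʳ (*-congˡ (≡⇒≈ (prodFin≡∏ m (λ k → app M′ (forest/ F S ∣ blockOf g k))))))
             (compTerm-assoc F S M M′ M″ m Q g _ g∘block≗f)

    coverᵇ-quotient-difference : ∀ U S → S ⊆ᵇ U ≡ true → coverᵇ F S ≡ true → coverᵇ (forest/ F S) (shrink/ F S (U ∩ ∁ S)) ≡ coverᵇ F U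
    coverᵇ-quotient-difference U S S⊆U S-cover =
      P.trans (coverᵇ-quotient F S (U ∩ ∁ S) S-cover (P.trans (⊆ᵇheads≡disjointᵇ F S (U ∩ ∁ S) S-cover) (disjointᵇ-∩∁ S U)))
      (P.trans (cong (_∧ coverᵇ F (U ∩ ∁ S)) (P.sym S-cover))
      (P.trans (P.sym (coverᵇ-∪ F S (U ∩ ∁ S))) (cong (coverᵇ F) (∪-∩∁-⊆ᵇ S U S⊆U))))

    termˡ≈termʳ-⊆ : ∀ U S → S ⊆ᵇ U ≡ true → termˡ S U ≈ termʳ U S
    termˡ≈termʳ-⊆ U S S⊆U
      rewrite coverAdmissible≡coverᵇ F S | coverAdmissible≡coverᵇ F U | coverAdmissible≡coverᵇ (forest/ F S) (shrink/ F S (U ∩ ∁ S))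
      with coverᵇ F U in U-cover
    ... | false with coverᵇ F S in S-cover
    ...   | false = ≈refl
    ...   | true rewrite P.trans (coverᵇ-quotient-difference U S S⊆U S-cover) U-cover = zeroˡ _
    termˡ≈termʳ-⊆ U S S⊆U | true
      rewrite coverᵇ-⊆ᵇ F S U S⊆U U-cover | P.trans (coverᵇ-quotient-difference U S S⊆U (coverᵇ-⊆ᵇ F S U S⊆U U-cover)) U-cover =
      ≈trans (compTerm-quotient≈termʳ U S S⊆U)
             (*-congˡ (∏-cong (size/ F U) (λ k → ≈sym (when-true _
               (P.trans (coverAdmissible≡coverᵇ (forest∣ F (block U k)) (shrink∣ F (block U k) S)) (coverᵇ-block F S U U-cover S⊆U k))))))

    termˡ≈termʳ : ∀ U S → when (S ⊆ᵇ U) (termˡ S U) ≈ termʳ U S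
    termˡ≈termʳ U S with S ⊆ᵇ U in S⊆U
    ... | false = ≈sym (termʳ-vanishes U S S⊆U)
    ... | true = termˡ≈termʳ-⊆ U S S⊆U

  ⊚-assoc : ∀ (M M′ M″ : Mould) → ((M ⊚ M′) ⊚ M″) ≋ (M ⊚ (M′ ⊚ M″))
  ⊚-assoc M M′ M″ {n} F = begin
    ((M ⊚ M′) ⊚ M″) F                                                ≈⟨ expansionˡ ⟩
    ∑ n (λ S → ∑ n (λ X → summandˡ S X))                             ≈⟨ ∑-cong n (λ S → ∑-cong n (summandˡ≈termˡ S)) ⟩
    ∑ n (λ S → ∑ n (λ X → when (disjointᵇ S X) (termˡ S (S ∪ X))))  ≈⟨ ∑-nested-⊆ᵇ n termˡ ⟨
    ∑ n (λ U → ∑ n (λ S → when (S ⊆ᵇ U) (termˡ S U)))               ≈⟨ ∑-cong n (λ U → ∑-cong n (termˡ≈termʳ U)) ⟩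
    ∑ n (λ U → ∑ n (λ S → termʳ U S))                                ≈⟨ expansionʳ ⟨
    (M ⊚ (M′ ⊚ M″)) F                                                ∎
    where open CompositionAssociativity M M′ M″ F

proposition5p7 : ∀ {c ℓ o} (R : CommutativeRing c ℓ) (Ω : Set o) (_⊕_ : Ω → Ω → Ω)
    → IsCommutativeSemigroup _≡_ _⊕_
    → let open MouldOps R _⊕_ in
      (∀ (M M′ M″ : Mould) → Invariant M → Invariant M′ → Invariant M″
         → ((M ⊠ M′) ⊠ M″) ≋ (M ⊠ (M′ ⊠ M″)))
    × (∀ (M M′ M″ : Mould) → Invariant M → Invariant M′ → Invariant M″
         → ((M ⊚ M′) ⊚ M″) ≋ (M ⊚ (M′ ⊚ M″)))
    × (∀ (M M′ N : Mould) → Invariant M → Invariant M′ → Invariant N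
         → ((M ⊠ M′) ⊚ N) ≋ ((M ⊚ N) ⊠ (M′ ⊚ N)))
    × (∀ (M : Mould) → Invariant M → ((ε ⊠ M) ≋ M) × ((M ⊠ ε) ≋ M))
    × (∀ (M : Mould) → Invariant M → (M ⊚ I<) ≋ M)
-- Forests are concrete presentations and the identities hold presentation by
-- presentation.
proposition5p7 R Ω _⊕_ ⊕-semigroup =
    (λ M M′ M″ _ _ _ → ⊠-assoc M M′ M″)
  , (λ M M′ M″ _ _ _ → ⊚-assoc M M′ M″)
  , (λ M M′ N _ _ _ → ⊚-distribʳ-⊠ M M′ N)
  , (λ M _ → ⊠-identityˡ M , ⊠-identityʳ M)
  , (λ M _ → ⊚-identityʳ M)
  where open Moulds R _⊕_ (IsCommutativeSemigroup.assoc ⊕-semigroup) (IsCommutativeSemigroup.comm ⊕-semigroup)
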